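{- Let $m$ be a positive integer with $\omega(m)\ge 2$. Then the $n$-ary function $\mathrm{AND}_n$ can be realized by probabilistic $\mathrm{CC}_2[m]$-circuits of size polynomial in $n$ using $O(\log n)$ random bits: there is a circuit $\Gamma_n$ with $n+r$ inputs, $r=O(\log n)$, of size $\mathrm{poly}(n)$, such that for every $\bar a\in\{0,1\}^n$, for at least $2/3$ of the tuples $\bar b\in\{0,1\}^r$ we have $\Gamma_n(\bar a,\bar b)=\mathrm{AND}_n(\bar a)$. Moreover, for any two different primes $p,q$ such circuits can be taken to be $\mathrm{CC}[p;q]$-circuits.
   Context: For $A\subseteq\{0,\dots,m-1\}$, the gate $\mathrm{MOD}_m^A$ (unbounded fan-in) outputs $1$ iff the sum of its boolean inputs modulo $m$ lies in $A$; multiple wires between gates (including input gates) are allowed. A $\mathrm{CC}_h[m]$-circuit is a depth-$h$ circuit built of gates $\mathrm{MOD}_m^A$. A $\mathrm{CC}[m_1;\dots;m_h]$-circuit is a depth-$h$ circuit whose gates on the $i$-th level are of the form $\mathrm{MOD}_{m_i}^A$. Size is the number of gates. $\omega(m)$ is the number of distinct prime divisors of $m$. -}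

module Defs where

open import Data.Nat using (ℕ; zero; suc; _+_; _*_; _^_; _≤_; NonZero)
open import Data.Nat.DivMod using (_mod_)
open import Data.Nat.Divisibility using (_∣?_)
open import Data.Nat.Primality using (prime?)
open import Data.Nat.Logarithm using (⌊log₂_⌋)
open import Data.Bool using (Bool; true; false; _∧_; if_then_else_)
open import Data.Bool.Properties using () renaming (_≟_ to _≟ᵇ_)
open import Data.Fin using (Fin)
open import Data.List using (List; []; _∷_; length; filter; upTo; map; concatMap)
open import Data.Vec as Vec using (Vec; lookup; tabulate; _++_)
open import Data.Product using (Σ; ∃; ∃-syntax; _×_; _,_)
open import Relation.Nullary using (_×-dec_)
open import Relation.Binary.PropositionalEquality using (_≡_)

ω : ℕ → ℕ
ω m = length (filter (λ p → prime? p ×-dec (p ∣? m)) (upTo (suc m)))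

bit : Bool → ℕ
bit true  = 1
bit false = 0

wsum : ∀ {k} → (Fin k → ℕ) → Vec Bool k → ℕ
wsum w x = Vec.sum (tabulate (λ i → w i * bit (lookup x i)))

-- MOD_m^A gate, A ⊆ {0,…,m-1} given as a characteristic function on Fin m
modGate : (m : ℕ) .{{_ : NonZero m}} → (Fin m → Bool) → ℕ → Bool
modGate m A s = A (s mod m)

-- Depth-2 layered circuit with k input gates: s gates MOD_{m₁}^{A₁ j} on level 1
-- (wires from input i with multiplicity w₁ j i), and one output gate
-- MOD_{m₂}^{A₂} on level 2 (wires from level-1 gate j with multiplicity w₂ j).
record Circuit2 (m₁ m₂ k : ℕ) : Set where
  field
    s  : ℕ
    A₁ : Fin s → Fin m₁ → Bool
    w₁ : Fin s → Fin k → ℕ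
    A₂ : Fin m₂ → Bool
    w₂ : Fin s → ℕ

open Circuit2 public

-- size = number of (non-input) gates
size : ∀ {m₁ m₂ k} → Circuit2 m₁ m₂ k → ℕ
size C = suc (s C)

eval : ∀ {m₁ m₂ k} .{{_ : NonZero m₁}} .{{_ : NonZero m₂}} →
       Circuit2 m₁ m₂ k → Vec Bool k → Bool
eval {m₁} {m₂} C x =
  modGate m₂ (A₂ C) (wsum (w₂ C) (tabulate (λ j → modGate m₁ (A₁ C j) (wsum (w₁ C j) x))))

AND : ∀ {n} → Vec Bool n → Bool
AND = Vec.foldr _ _∧_ true

allVecs : (r : ℕ) → List (Vec Bool r)
allVecs zero    = Vec.[] ∷ []
allVecs (suc r) = concatMap (λ v → (false Vec.∷ v) ∷ (true Vec.∷ v) ∷ []) (allVecs r)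

goodCount : ∀ {m₁ m₂ n r} .{{_ : NonZero m₁}} .{{_ : NonZero m₂}} →
            Circuit2 m₁ m₂ (n + r) → Vec Bool n → ℕ
goodCount {r = r} Γ a = length (filter (λ b → eval Γ (a ++ b) ≟ᵇ AND a) (allVecs r))

ProbANDFamily : (m₁ m₂ : ℕ) .{{_ : NonZero m₁}} .{{_ : NonZero m₂}} → Set
ProbANDFamily m₁ m₂ =
  ∃[ c ] ∃[ d ] ∀ (n : ℕ) → ∃[ r ] (r ≤ c * suc ⌊log₂ n ⌋) ×
    (Σ (Circuit2 m₁ m₂ (n + r)) λ Γ →
        (size Γ ≤ c * suc n ^ d) ×
        (∀ (a : Vec Bool n) → 2 * 2 ^ r ≤ 3 * goodCount Γ a))

module Submission where

-- For ā ∈ {0,1}ⁿ let f_ā(t) = ∑_{i : āᵢ = 0} tⁱ over a finite field F of characteristic p.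
-- AND(ā) = 1 iff f_ā is the zero polynomial; otherwise f_ā has fewer than n roots. F is a
-- tower of quadratic extensions of F_p of dimension r = 2^J ≥ log₂(3n), so r random bits
-- name a point t_b of F, and f_ā(t_b) = 0 is wrong for at most a third of all b. The
-- F_p-coordinates of f_ā(t_β) are affine in ā, and the simultaneous vanishing mod p of
-- finitely many affine values y is detected by one MOD_q gate over MOD_p gates, because
-- ∑_{a ∈ F_pᵏ} w(c + a·y mod p), with w(0) = 1 and w(1) = q - 1, is pᵏ w(c) when all yⱼ ≡ 0
-- and ≡ 0 (mod q) otherwise. Adding tests bₗ = βₗ and summing over all β ∈ {0,1}ʳ gives a
-- CC[p;q] circuit that accepts exactly when f_ā(t_b) = 0. MOD_{pu} gates simulate MOD_p gates
-- by multiplying all wire multiplicities by u, which covers every m with two prime factors.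

open import Defs
open import Data.Nat using (ℕ; _≤_; NonZero)
open import Data.Nat.Primality using (Prime)
open import Data.Product using (_×_)
open import Relation.Binary.PropositionalEquality using (_≢_)

open import Algebra.Bundles using (CommutativeRing; Semiring)
open import Algebra.Structures using (IsCommutativeRing)
import Algebra.Properties.Semiring.Sum
open import Data.Bool using (Bool; true; false; not; if_then_else_)
open import Data.Bool.Properties using () renaming (_≟_ to _≟ᵇ_)
open import Data.Fin as Fin using (Fin; zero; suc; toℕ; _↑ˡ_; _↑ʳ_; splitAt)
import Data.Fin.Properties as Finₚ
open import Data.Fin.Permutation using (permutation)
open import Data.List as List using (List; []; _∷_; length; map; concatMap; allFin)
import Data.List.Properties as Listₚ
open import Data.List.Relation.Unary.All using (All; []; _∷_; universal) renaming (zipWith to zipWithAll)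
import Data.List.Relation.Unary.All.Properties as Allₚ
open import Data.List.Relation.Unary.AllPairs using ([]; _∷_)
open import Data.List.Relation.Unary.Unique.Propositional using (Unique)
import Data.List.Relation.Unary.Unique.Propositional.Properties as Uniqueₚ
open import Data.Nat as Nat using (zero; suc; _<_; _∸_; _%_)
open import Data.Nat.DivMod
open import Data.Nat.Divisibility
  using (_∣_; _∣?_; _∣0; ∣1⇒≡1; m∣m*n; n∣m*n; ∣m∣n⇒∣m+n; ∣n⇒∣m*n; m%n≡0⇒n∣m; n∣m⇒m%n≡0;
         quotient; quotient≢0; m∣n⇒n≡m*quotient)
open import Data.Nat.ListAction using (sum)
open import Data.Nat.ListAction.Properties using (sum-++)
open import Data.Nat.Logarithm using (⌊log₂_⌋; ⌊log₂⌋-mono-≤; ⌊log₂[2^n]⌋≡n)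
open import Data.Nat.Primality
  using (prime?; ¬prime[1]; euclidsLemma; prime⇒irreducible; prime⇒nonZero; prime⇒nonTrivial)
import Data.Nat.Properties as ℕₚ
open import Data.Nat.Solver using (module +-*-Solver)
open import Data.Product as Product using (Σ; ∃; _,_; proj₁; proj₂)
open import Data.Product.Properties using (≡-dec)
open import Data.Sum using (_⊎_; inj₁; inj₂; [_,_]′)
open import Data.Vec as Vec using (Vec; []; _∷_; lookup; tabulate; _++_)
import Data.Vec.Properties as Vecₚ
open import Function using (_∘_)
open import Level using (0ℓ)
open import Relation.Binary.Definitions using (DecidableEquality)
open import Relation.Binary.PropositionalEquality
  using (_≡_; refl; sym; trans; cong; cong₂; subst; isEquivalence; module ≡-Reasoning)
open import Relation.Nullary using (¬_; Dec; yes; no; does; ¬?; _×-dec_)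
open import Relation.Nullary.Decidable using (dec-true; dec-false)
open import Relation.Nullary.Negation using (contradiction)

-- Arithmetic modulo d and finite sums

module Σℕ = Algebra.Properties.Semiring.Sum ℕₚ.+-*-semiring

module _ where

  open Nat using (_+_; _*_)

  [m%d+n]%d≡[m+n]%d : ∀ m n d .{{_ : NonZero d}} → (m % d + n) % d ≡ (m + n) % d
  [m%d+n]%d≡[m+n]%d m n d = begin
    (m % d + n) % d            ≡⟨ %-distribˡ-+ (m % d) n d ⟩
    (m % d % d + n % d) % d    ≡⟨ cong (λ x → (x + n % d) % d) (m%n%n≡m%n m d) ⟩
    (m % d + n % d) % d        ≡⟨ %-distribˡ-+ m n d ⟨
    (m + n) % d                ∎
    where open ≡-Reasoning

  [m+n%d]%d≡[m+n]%d : ∀ m n d .{{_ : NonZero d}} → (m + n % d) % d ≡ (m + n) % d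
  [m+n%d]%d≡[m+n]%d m n d = trans (cong (_% d) (ℕₚ.+-comm m _))
    (trans ([m%d+n]%d≡[m+n]%d n m d) (cong (_% d) (ℕₚ.+-comm n m)))

  [m%d*n]%d≡[m*n]%d : ∀ m n d .{{_ : NonZero d}} → (m % d * n) % d ≡ (m * n) % d
  [m%d*n]%d≡[m*n]%d m n d = begin
    (m % d * n) % d            ≡⟨ %-distribˡ-* (m % d) n d ⟩
    (m % d % d * (n % d)) % d  ≡⟨ cong (λ x → (x * (n % d)) % d) (m%n%n≡m%n m d) ⟩
    (m % d * (n % d)) % d      ≡⟨ %-distribˡ-* m n d ⟨
    (m * n) % d                ∎
    where open ≡-Reasoning

  [m*n%d]%d≡[m*n]%d : ∀ m n d .{{_ : NonZero d}} → (m * (n % d)) % d ≡ (m * n) % d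
  [m*n%d]%d≡[m*n]%d m n d = trans (cong (_% d) (ℕₚ.*-comm m _))
    (trans ([m%d*n]%d≡[m*n]%d n m d) (cong (_% d) (ℕₚ.*-comm n m)))

instance
  *-nonZero : ∀ {m n} .{{_ : NonZero m}} .{{_ : NonZero n}} → NonZero (m Nat.* n)
  *-nonZero {m} {n} = ℕₚ.m*n≢0 m n

Injective : ∀ {n} → (Fin n → Fin n) → Set
Injective g = ∀ {i j} → g i ≡ g j → i ≡ j

Surjective : ∀ {n} → (Fin n → Fin n) → Set
Surjective g = ∀ y → ∃ λ x → g x ≡ y

injective⇒surjective : ∀ {n} (g : Fin n → Fin n) → Injective g → Surjective g
injective⇒surjective {zero} g inj ()
injective⇒surjective {suc n} g inj y with Finₚ.any? (λ x → g x Finₚ.≟ y)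
... | yes hit = hit
... | no miss =
  let i , j , i<j , collision = Finₚ.pigeonhole (ℕₚ.n<1+n n) (Fin.punchOut ∘ missed)
  in contradiction (inj (Finₚ.punchOut-injective (missed i) (missed j) collision)) (Finₚ.<⇒≢ i<j)
  where
  missed : ∀ x → y ≢ g x
  missed x e = miss (x , sym e)

surjective⇒injective : ∀ {n} (g : Fin n → Fin n) → Surjective g → Injective g
surjective⇒injective {n} g surj {i} {j} gi≡gj = begin
  i               ≡⟨ section-retract i ⟨
  sec (g i)       ≡⟨ cong sec gi≡gj ⟩
  sec (g j)       ≡⟨ section-retract j ⟩
  j               ∎
  where
  open ≡-Reasoning
  sec : Fin n → Fin n
  sec = proj₁ ∘ surj
  g∘sec : ∀ y → g (sec y) ≡ y
  g∘sec = proj₂ ∘ surj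
  sec-injective : Injective sec
  sec-injective {a} {b} e = trans (sym (g∘sec a)) (trans (cong g e) (g∘sec b))
  -- sec is injective, hence surjective, and so a two-sided inverse of g.
  section-retract : ∀ x → sec (g x) ≡ x
  section-retract x with injective⇒surjective sec sec-injective x
  ... | y , sec-y≡x = trans (cong (sec ∘ g) (sym sec-y≡x)) (trans (cong sec (g∘sec y)) sec-y≡x)

¬surjective⇒missed : ∀ {n} (g : Fin n → Fin n) → ¬ Surjective g → ∃ λ y → ∀ x → g x ≢ y
¬surjective⇒missed g ¬surj with Finₚ.any? (λ y → Finₚ.all? (λ x → ¬? (g x Finₚ.≟ y)))
... | yes missed = missed
... | no ¬missed = contradiction surj ¬surj
  where
  surj : Surjective g
  surj y with Finₚ.any? (λ x → g x Finₚ.≟ y)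
  ... | yes hit = hit
  ... | no miss = contradiction (y , λ x e → miss (x , e)) ¬missed

sum-reindex : ∀ {n} (g : Fin n → Fin n) → Injective g → (f : Fin n → ℕ) → Σℕ.sum f ≡ Σℕ.sum (f ∘ g)
sum-reindex {n} g g-injective f = Σℕ.∑-permute f (permutation g g⁻¹ g∘g⁻¹ (λ x → g-injective (g∘g⁻¹ (g x))))
  where
  g⁻¹ : Fin n → Fin n
  g⁻¹ = proj₁ ∘ injective⇒surjective g g-injective
  g∘g⁻¹ : ∀ y → g (g⁻¹ y) ≡ y
  g∘g⁻¹ = proj₂ ∘ injective⇒surjective g g-injective

∣-sum : ∀ {d n} {f : Fin n → ℕ} → (∀ i → d ∣ f i) → d ∣ Σℕ.sum f
∣-sum {d} {zero}  _ = d ∣0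
∣-sum {d} {suc n} h = ∣m∣n⇒∣m+n (h zero) (∣-sum (h ∘ suc))

sum-const : ∀ n c → Σℕ.sum {n} (λ _ → c) ≡ n Nat.* c
sum-const zero    c = refl
sum-const (suc n) c = cong (c Nat.+_) (sum-const n c)

module _ {A B : Set} where

  sum-map-concatMap : ∀ (h : A → List B) (f : B → ℕ) xs →
                      sum (map f (concatMap h xs)) ≡ sum (map (λ x → sum (map f (h x))) xs)
  sum-map-concatMap h f []       = refl
  sum-map-concatMap h f (x ∷ xs) = begin
    sum (map f (h x List.++ concatMap h xs))                       ≡⟨ cong sum (Listₚ.map-++ f (h x) _) ⟩
    sum (map f (h x) List.++ map f (concatMap h xs))               ≡⟨ sum-++ (map f (h x)) _ ⟩
    sum (map f (h x)) Nat.+ sum (map f (concatMap h xs))           ≡⟨ cong (sum (map f (h x)) Nat.+_) (sum-map-concatMap h f xs) ⟩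
    sum (map f (h x)) Nat.+ sum (map (λ x → sum (map f (h x))) xs) ∎
    where open ≡-Reasoning

  length-concatMap : ∀ (h : A → List B) xs → length (concatMap h xs) ≡ sum (map (length ∘ h) xs)
  length-concatMap h []       = refl
  length-concatMap h (x ∷ xs) = trans (Listₚ.length-++ (h x)) (cong (length (h x) Nat.+_) (length-concatMap h xs))

sum-map-lookup : ∀ {A : Set} (f : A → ℕ) xs → Σℕ.sum (f ∘ List.lookup xs) ≡ sum (map f xs)
sum-map-lookup f []       = refl
sum-map-lookup f (x ∷ xs) = cong (f x Nat.+_) (sum-map-lookup f xs)

sum-map-const : ∀ {A : Set} (xs : List A) c → sum (map (λ _ → c) xs) ≡ length xs Nat.* c
sum-map-const []       c = refl
sum-map-const (x ∷ xs) c = cong (c Nat.+_) (sum-map-const xs c)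

sum-tabulate : ∀ {n} (f : Fin n → ℕ) → sum (List.tabulate f) ≡ Σℕ.sum f
sum-tabulate {zero}  f = refl
sum-tabulate {suc n} f = cong (f zero Nat.+_) (sum-tabulate (f ∘ suc))

sum-map-allFin : ∀ {n} (f : Fin n → ℕ) → sum (map f (allFin n)) ≡ Σℕ.sum f
sum-map-allFin f = trans (cong sum (Listₚ.map-tabulate (λ i → i) f)) (sum-tabulate f)

sum-↑ : ∀ {n r} (h : Fin (n Nat.+ r) → ℕ) → Σℕ.sum h ≡ Σℕ.sum (h ∘ (_↑ˡ r)) Nat.+ Σℕ.sum (h ∘ (n ↑ʳ_))
sum-↑ {zero}      h = refl
sum-↑ {suc n} {r} h = trans (cong (h zero Nat.+_) (sum-↑ {n} {r} (h ∘ suc))) (sym (ℕₚ.+-assoc (h zero) _ _))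

sum-unit : ∀ {m} (ℓ : Fin m) w (g : Fin m → ℕ) →
           Σℕ.sum (λ j → (if does (j Finₚ.≟ ℓ) then w else 0) Nat.* g j) ≡ w Nat.* g ℓ
sum-unit {suc m} zero    w g = trans (cong (w Nat.* g zero Nat.+_) (Σℕ.sum-replicate-zero m)) (ℕₚ.+-identityʳ _)
sum-unit {suc m} (suc ℓ) w g = sum-unit ℓ w (g ∘ suc)

vec-ext : ∀ {A : Set} {n} {u v : Vec A n} → (∀ i → lookup u i ≡ lookup v i) → u ≡ v
vec-ext {u = u} {v} u≗v = trans (sym (Vecₚ.tabulate∘lookup u)) (trans (Vecₚ.tabulate-cong u≗v) (Vecₚ.tabulate∘lookup v))

length-filter-∁ : ∀ {A : Set} {P : A → Set} (P? : ∀ x → Dec (P x)) xs →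
                  length (List.filter P? xs) Nat.+ length (List.filter (¬? ∘ P?) xs) ≡ length xs
length-filter-∁ P? []       = refl
length-filter-∁ P? (x ∷ xs) with P? x
... | yes _ = cong suc (length-filter-∁ P? xs)
... | no  _ = trans (ℕₚ.+-suc _ _) (cong suc (length-filter-∁ P? xs))

sum-map-% : ∀ {A : Set} (f : A → ℕ) xs d .{{_ : NonZero d}} → sum (map f xs) % d ≡ sum (map ((_% d) ∘ f) xs) % d
sum-map-% f []       d = refl
sum-map-% f (x ∷ xs) d = begin
  (f x Nat.+ sum (map f xs)) % d                        ≡⟨ [m%d+n]%d≡[m+n]%d (f x) _ d ⟨
  (f x % d Nat.+ sum (map f xs)) % d                    ≡⟨ [m+n%d]%d≡[m+n]%d (f x % d) _ d ⟨
  (f x % d Nat.+ sum (map f xs) % d) % d                ≡⟨ cong (λ y → (f x % d Nat.+ y) % d) (sum-map-% f xs d) ⟩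
  (f x % d Nat.+ sum (map ((_% d) ∘ f) xs) % d) % d     ≡⟨ [m+n%d]%d≡[m+n]%d (f x % d) _ d ⟩
  (f x % d Nat.+ sum (map ((_% d) ∘ f) xs)) % d         ∎
  where open ≡-Reasoning

-- Finite fields with F_p-coordinates

mkIsCommutativeRing : ∀ {C : Set} (_+_ _*_ : C → C → C) (-_ : C → C) (0# 1# : C) →
  (∀ x y z → (x + y) + z ≡ x + (y + z)) → (∀ x y → x + y ≡ y + x) →
  (∀ x → 0# + x ≡ x) → (∀ x → (- x) + x ≡ 0#) →
  (∀ x y z → (x * y) * z ≡ x * (y * z)) → (∀ x y → x * y ≡ y * x) →
  (∀ x → 1# * x ≡ x) → (∀ x y z → (y + z) * x ≡ (y * x) + (z * x)) →
  IsCommutativeRing _≡_ _+_ _*_ -_ 0# 1#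
mkIsCommutativeRing _+_ _*_ -_ 0# 1# +-assoc +-comm +-identityˡ -‿inverseˡ *-assoc *-comm *-identityˡ distribʳ =
  record
  { isRing = record
    { +-isAbelianGroup = record
      { isGroup = record
        { isMonoid = record
          { isSemigroup = record
            { isMagma = record { isEquivalence = isEquivalence ; ∙-cong = cong₂ _+_ }
            ; assoc = +-assoc }
          ; identity = +-identityˡ , λ x → trans (+-comm x 0#) (+-identityˡ x) }
        ; inverse = -‿inverseˡ , λ x → trans (+-comm x (- x)) (-‿inverseˡ x)
        ; ⁻¹-cong = cong -_ }
      ; comm = +-comm }
    ; *-cong = cong₂ _*_
    ; *-assoc = *-assoc
    ; *-identity = *-identityˡ , λ x → trans (*-comm x 1#) (*-identityˡ x)
    ; distrib = (λ x y z → trans (*-comm x (y + z)) (trans (distribʳ x y z) (cong₂ _+_ (*-comm y x) (*-comm z x))))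
              , distribʳ }
  ; *-comm = *-comm }

-- A finite integral domain together with an additive coordinate map to F_p^dim
-- (coordinates are residues in ℕ) and a section of it on 0/1 vectors.
record CoordField (p : ℕ) .{{_ : NonZero p}} : Set₁ where
  infixl 6 _+_
  infixl 7 _*_
  infix  8 -_
  field
    Carrier : Set
    _≟_ : DecidableEquality Carrier
    _+_ _*_ : Carrier → Carrier → Carrier
    -_ : Carrier → Carrier
    0# 1# : Carrier
    isCommutativeRing : IsCommutativeRing _≡_ _+_ _*_ -_ 0# 1#
    zero-product : ∀ {a b} → a * b ≡ 0# → a ≡ 0# ⊎ b ≡ 0#
    1≢0 : 1# ≢ 0#
    card : ℕ
    encode : Carrier → Fin card
    decode : Fin card → Carrier
    decode-encode : ∀ x → decode (encode x) ≡ x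
    encode-decode : ∀ i → encode (decode i) ≡ i
    dim : ℕ
    coord : Carrier → Fin dim → ℕ
    coord-+ : ∀ x y l → coord (x + y) l ≡ (coord x l Nat.+ coord y l) % p
    coord-0# : ∀ l → coord 0# l ≡ 0
    coord≡0⇒≡0# : ∀ x → (∀ l → coord x l ≡ 0) → x ≡ 0#
    fromBits : (Fin dim → Bool) → Carrier
    coord-fromBits : ∀ β l → coord (fromBits β) l ≡ bit (β l)

module IntegersModPrime (p : ℕ) .{{_ : NonZero p}} (p-prime : Prime p) where

  open Nat using (_+_; _*_)

  1<p : 1 < p
  1<p = Nat.nonTrivial⇒n>1 p {{prime⇒nonTrivial p-prime}}

  [_] : ℕ → Fin p
  [ m ] = m mod p

  toℕ-[] : ∀ m → toℕ [ m ] ≡ m % p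
  toℕ-[] m = Finₚ.toℕ-fromℕ< (m%n<n m p)

  %-self : ∀ (a : Fin p) → toℕ a % p ≡ toℕ a
  %-self a = m<n⇒m%n≡m (Finₚ.toℕ<n a)

  []-cong : ∀ {m n} → m % p ≡ n % p → [ m ] ≡ [ n ]
  []-cong {m} {n} e = Finₚ.toℕ-injective (trans (toℕ-[] m) (trans e (sym (toℕ-[] n))))

  []-toℕ : ∀ a → [ toℕ a ] ≡ a
  []-toℕ a = Finₚ.toℕ-injective (trans (toℕ-[] (toℕ a)) (%-self a))

  0%p : 0 % p ≡ 0
  0%p = m<n⇒m%n≡m (ℕₚ.<-trans (ℕₚ.n<1+n 0) 1<p)

  toℕ[0] : toℕ [ 0 ] ≡ 0
  toℕ[0] = trans (toℕ-[] 0) 0%p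

  toℕ[1] : toℕ [ 1 ] ≡ 1
  toℕ[1] = trans (toℕ-[] 1) (m<n⇒m%n≡m 1<p)

  absorb-+ˡ : ∀ m n → (toℕ [ m ] + n) % p ≡ (m + n) % p
  absorb-+ˡ m n = trans (cong (λ x → (x + n) % p) (toℕ-[] m)) ([m%d+n]%d≡[m+n]%d m n p)

  absorb-+ʳ : ∀ m n → (m + toℕ [ n ]) % p ≡ (m + n) % p
  absorb-+ʳ m n = trans (cong (λ x → (m + x) % p) (toℕ-[] n)) ([m+n%d]%d≡[m+n]%d m n p)

  absorb-*ˡ : ∀ m n → (toℕ [ m ] * n) % p ≡ (m * n) % p
  absorb-*ˡ m n = trans (cong (λ x → (x * n) % p) (toℕ-[] m)) ([m%d*n]%d≡[m*n]%d m n p)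

  absorb-*ʳ : ∀ m n → (m * toℕ [ n ]) % p ≡ (m * n) % p
  absorb-*ʳ m n = trans (cong (λ x → (m * x) % p) (toℕ-[] n)) ([m*n%d]%d≡[m*n]%d m n p)

  infixl 6 _⊕_
  infixl 7 _⊗_
  _⊕_ _⊗_ : Fin p → Fin p → Fin p
  a ⊕ b = [ toℕ a + toℕ b ]
  a ⊗ b = [ toℕ a * toℕ b ]

  ⊖_ : Fin p → Fin p
  ⊖ a = [ p ∸ toℕ a ]

  ⊕-assoc : ∀ a b c → (a ⊕ b) ⊕ c ≡ a ⊕ (b ⊕ c)
  ⊕-assoc a b c = []-cong (trans (absorb-+ˡ _ _)
    (trans (cong (_% p) (ℕₚ.+-assoc (toℕ a) _ _)) (sym (absorb-+ʳ (toℕ a) _))))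

  ⊕-comm : ∀ a b → a ⊕ b ≡ b ⊕ a
  ⊕-comm a b = cong [_] (ℕₚ.+-comm (toℕ a) (toℕ b))

  ⊕-identityˡ : ∀ a → [ 0 ] ⊕ a ≡ a
  ⊕-identityˡ a = trans (cong (λ x → [ x + toℕ a ]) toℕ[0]) ([]-toℕ a)

  ⊖-inverseˡ : ∀ a → ⊖ a ⊕ a ≡ [ 0 ]
  ⊖-inverseˡ a = []-cong (trans (absorb-+ˡ _ _)
    (trans (cong (_% p) (ℕₚ.m∸n+n≡m (ℕₚ.<⇒≤ (Finₚ.toℕ<n a)))) (trans (n%n≡0 p) (sym 0%p))))

  ⊗-assoc : ∀ a b c → (a ⊗ b) ⊗ c ≡ a ⊗ (b ⊗ c)
  ⊗-assoc a b c = []-cong (trans (absorb-*ˡ _ _)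
    (trans (cong (_% p) (ℕₚ.*-assoc (toℕ a) _ _)) (sym (absorb-*ʳ (toℕ a) _))))

  ⊗-comm : ∀ a b → a ⊗ b ≡ b ⊗ a
  ⊗-comm a b = cong [_] (ℕₚ.*-comm (toℕ a) (toℕ b))

  ⊗-identityˡ : ∀ a → [ 1 ] ⊗ a ≡ a
  ⊗-identityˡ a = trans (cong (λ x → [ x * toℕ a ]) toℕ[1]) (trans (cong [_] (ℕₚ.*-identityˡ _)) ([]-toℕ a))

  ⊗-distribʳ-⊕ : ∀ a b c → (b ⊕ c) ⊗ a ≡ b ⊗ a ⊕ c ⊗ a
  ⊗-distribʳ-⊕ a b c = []-cong (begin
    (toℕ (b ⊕ c) * toℕ a) % p                         ≡⟨ absorb-*ˡ _ _ ⟩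
    ((toℕ b + toℕ c) * toℕ a) % p                     ≡⟨ cong (_% p) (ℕₚ.*-distribʳ-+ (toℕ a) (toℕ b) _) ⟩
    (toℕ b * toℕ a + toℕ c * toℕ a) % p               ≡⟨ absorb-+ˡ _ _ ⟨
    (toℕ (b ⊗ a) + toℕ c * toℕ a) % p                 ≡⟨ absorb-+ʳ _ _ ⟨
    (toℕ (b ⊗ a) + toℕ (c ⊗ a)) % p                   ∎)
    where open ≡-Reasoning

  <p∧p∣⇒≡0 : ∀ {m} → m < p → p ∣ m → m ≡ 0
  <p∧p∣⇒≡0 {m} m<p p∣m = trans (sym (m<n⇒m%n≡m m<p)) (n∣m⇒m%n≡0 m p p∣m)

  ⊗-zero-product : ∀ {a b} → a ⊗ b ≡ [ 0 ] → a ≡ [ 0 ] ⊎ b ≡ [ 0 ]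
  ⊗-zero-product {a} {b} ab≡0
    with euclidsLemma (toℕ a) (toℕ b) p-prime (m%n≡0⇒n∣m _ p (trans (sym (toℕ-[] _)) (trans (cong toℕ ab≡0) toℕ[0])))
  ... | inj₁ p∣a = inj₁ (Finₚ.toℕ-injective (trans (<p∧p∣⇒≡0 (Finₚ.toℕ<n a) p∣a) (sym toℕ[0])))
  ... | inj₂ p∣b = inj₂ (Finₚ.toℕ-injective (trans (<p∧p∣⇒≡0 (Finₚ.toℕ<n b) p∣b) (sym toℕ[0])))

  toℕ-[bit] : ∀ b → toℕ [ bit b ] ≡ bit b
  toℕ-[bit] false = toℕ[0]
  toℕ-[bit] true  = toℕ[1]

  coordField : CoordField p
  coordField = record
    { Carrier = Fin p
    ; _≟_ = Finₚ._≟_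
    ; _+_ = _⊕_
    ; _*_ = _⊗_
    ; -_ = ⊖_
    ; 0# = [ 0 ]
    ; 1# = [ 1 ]
    ; isCommutativeRing = mkIsCommutativeRing _⊕_ _⊗_ ⊖_ [ 0 ] [ 1 ]
        ⊕-assoc ⊕-comm ⊕-identityˡ ⊖-inverseˡ ⊗-assoc ⊗-comm ⊗-identityˡ ⊗-distribʳ-⊕
    ; zero-product = ⊗-zero-product
    ; 1≢0 = λ e → ℕₚ.1+n≢0 (trans (sym toℕ[1]) (trans (cong toℕ e) toℕ[0]))
    ; card = p
    ; encode = λ a → a
    ; decode = λ a → a
    ; decode-encode = λ _ → refl
    ; encode-decode = λ _ → refl
    ; dim = 1
    ; coord = λ a _ → toℕ a
    ; coord-+ = λ a b _ → toℕ-[] _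
    ; coord-0# = λ _ → toℕ[0]
    ; coord≡0⇒≡0# = λ a h → Finₚ.toℕ-injective (trans (h zero) (sym toℕ[0]))
    ; fromBits = λ β → [ bit (β zero) ]
    ; coord-fromBits = λ { β zero → toℕ-[bit] (β zero) }
    }

module CoordFieldProperties {p : ℕ} .{{_ : NonZero p}} (F : CoordField p) where

  open CoordField F public

  commutativeRing : CommutativeRing 0ℓ 0ℓ
  commutativeRing = record { isCommutativeRing = isCommutativeRing }

  open CommutativeRing commutativeRing public
    using (+-assoc; +-comm; +-identityˡ; +-identityʳ; -‿inverseˡ; -‿inverseʳ;
           *-assoc; *-comm; *-identityˡ; *-identityʳ; zeroˡ; zeroʳ; distribʳ; semiring)
  open import Algebra.Properties.Ring (CommutativeRing.ring commutativeRing) public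
    using (-‿involutive; -0#≈0#; -‿distribˡ-*; -‿distribʳ-*)
  open import Algebra.Properties.Group (CommutativeRing.+-group commutativeRing) public
    using (x∙y⁻¹≈ε⇒x≈y) renaming (∙-cancelˡ to +-cancelˡ)
  open import Algebra.Solver.Ring.NaturalCoefficients.Default
    (CommutativeRing.commutativeSemiring commutativeRing) public
    using (solve; _:=_; _:+_; _:*_; con)

  *-cancelʳ : ∀ {a b h} → a * h ≡ b * h → a ≢ b → h ≡ 0#
  *-cancelʳ {a} {b} {h} ah≡bh a≢b with zero-product (a-b·h≡0)
    where
    a-b·h≡0 : (a + - b) * h ≡ 0#
    a-b·h≡0 = begin
      (a + - b) * h       ≡⟨ distribʳ h a (- b) ⟩
      a * h + - b * h     ≡⟨ cong₂ _+_ ah≡bh (sym (-‿distribˡ-* b h)) ⟩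
      b * h + - (b * h)   ≡⟨ -‿inverseʳ (b * h) ⟩
      0#                  ∎
      where open ≡-Reasoning
  ... | inj₁ a-b≡0 = contradiction (x∙y⁻¹≈ε⇒x≈y a b a-b≡0) a≢b
  ... | inj₂ h≡0 = h≡0

  encode-injective : ∀ {x y} → encode x ≡ encode y → x ≡ y
  encode-injective {x} {y} e = trans (sym (decode-encode x)) (trans (cong decode e) (decode-encode y))

  decode-injective : ∀ {i j} → decode i ≡ decode j → i ≡ j
  decode-injective {i} {j} e = trans (sym (encode-decode i)) (trans (cong encode e) (encode-decode j))

  inverse : ∀ {a} → a ≢ 0# → ∃ λ b → a * b ≡ 1#
  inverse {a} a≢0 =
    let i , a·i≡1 = injective⇒surjective times-a times-a-injective (encode 1#)
    in decode i , encode-injective a·i≡1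
    where
    times-a : Fin card → Fin card
    times-a i = encode (a * decode i)
    times-a-injective : Injective times-a
    times-a-injective {i} {j} eq with decode i ≟ decode j
    ... | yes di≡dj = decode-injective di≡dj
    ... | no  di≢dj = contradiction (*-cancelʳ (trans (*-comm _ a) (trans (encode-injective eq) (*-comm a _))) di≢dj) a≢0

  w²+w : Carrier → Carrier
  w²+w w = w * w + w

  0#≢-1# : 0# ≢ - 1#
  0#≢-1# 0≡-1 = 1≢0 (begin
    1#          ≡⟨ -‿involutive 1# ⟨
    - (- 1#)    ≡⟨ cong -_ 0≡-1 ⟨
    - 0#        ≡⟨ -0#≈0# ⟩
    0#          ∎)
    where open ≡-Reasoning

  w²+w-0≡w²+w-[-1] : w²+w 0# ≡ w²+w (- 1#)
  w²+w-0≡w²+w-[-1] = begin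
    0# * 0# + 0#             ≡⟨ trans (cong (_+ 0#) (zeroˡ 0#)) (+-identityʳ 0#) ⟩
    0#                       ≡⟨ -‿inverseˡ (- 1#) ⟨
    - (- 1#) + - 1#          ≡⟨ cong (λ x → - x + - 1#) (*-identityˡ (- 1#)) ⟨
    - (1# * - 1#) + - 1#     ≡⟨ cong (_+ - 1#) (-‿distribˡ-* 1# (- 1#)) ⟩
    - 1# * - 1# + - 1#       ∎
    where open ≡-Reasoning

  -- w²+w is not injective, so by finiteness it misses some value.
  w²+w-missesValue : ∃ λ c → ∀ w → w²+w w ≢ c
  w²+w-missesValue =
    let y , missed = ¬surjective⇒missed g g-not-surjective
    in decode y , λ w e → missed (encode w) (begin
      encode (w²+w (decode (encode w)))  ≡⟨ cong (encode ∘ w²+w) (decode-encode w) ⟩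
      encode (w²+w w)                    ≡⟨ cong encode e ⟩
      encode (decode y)                  ≡⟨ encode-decode y ⟩
      y                                  ∎)
    where
    open ≡-Reasoning
    g : Fin card → Fin card
    g = encode ∘ w²+w ∘ decode
    g-not-surjective : ¬ Surjective g
    g-not-surjective surj = 0#≢-1# (encode-injective (surjective⇒injective g surj (begin
      encode (w²+w (decode (encode 0#)))      ≡⟨ cong (encode ∘ w²+w) (decode-encode 0#) ⟩
      encode (w²+w 0#)                        ≡⟨ cong encode w²+w-0≡w²+w-[-1] ⟩
      encode (w²+w (- 1#))                    ≡⟨ cong (encode ∘ w²+w) (decode-encode (- 1#)) ⟨
      encode (w²+w (decode (encode (- 1#))))  ∎)))

-- F(θ) with θ² = θ + c, where c is not of the form w² + w; this form of the
-- minimal polynomial keeps the construction valid in characteristic 2.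
module QuadraticExtension {p : ℕ} .{{_ : NonZero p}} (F : CoordField p) where

  open CoordFieldProperties F

  c : Carrier
  c = proj₁ w²+w-missesValue

  w²+w≢c : ∀ w → w²+w w ≢ c
  w²+w≢c = proj₂ w²+w-missesValue

  Pair : Set
  Pair = Carrier × Carrier

  infixl 6 _+′_
  infixl 7 _*′_
  _+′_ _*′_ : Pair → Pair → Pair
  (u , v) +′ (u′ , v′) = (u + u′ , v + v′)
  (u , v) *′ (u′ , v′) = (u * u′ + c * (v * v′) , u * v′ + v * u′ + v * v′)

  -′_ : Pair → Pair
  -′ (u , v) = (- u , - v)

  0′ 1′ : Pair
  0′ = (0# , 0#)
  1′ = (1# , 0#)

  +′-assoc : ∀ x y z → (x +′ y) +′ z ≡ x +′ (y +′ z)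
  +′-assoc (a , b) (a′ , b′) (a″ , b″) = cong₂ _,_ (+-assoc a a′ a″) (+-assoc b b′ b″)

  +′-comm : ∀ x y → x +′ y ≡ y +′ x
  +′-comm (a , b) (a′ , b′) = cong₂ _,_ (+-comm a a′) (+-comm b b′)

  +′-identityˡ : ∀ x → 0′ +′ x ≡ x
  +′-identityˡ (a , b) = cong₂ _,_ (+-identityˡ a) (+-identityˡ b)

  -′-inverseˡ : ∀ x → (-′ x) +′ x ≡ 0′
  -′-inverseˡ (a , b) = cong₂ _,_ (-‿inverseˡ a) (-‿inverseˡ b)

  *′-assoc : ∀ x y z → (x *′ y) *′ z ≡ x *′ (y *′ z)
  *′-assoc (a , b) (a′ , b′) (a″ , b″) = cong₂ _,_
    (solve 7 (λ a b a′ b′ a″ b″ c →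
         (a :* a′ :+ c :* (b :* b′)) :* a″ :+ c :* ((a :* b′ :+ b :* a′ :+ b :* b′) :* b″)
      := a :* (a′ :* a″ :+ c :* (b′ :* b″)) :+ c :* (b :* (a′ :* b″ :+ b′ :* a″ :+ b′ :* b″)))
      refl a b a′ b′ a″ b″ c)
    (solve 7 (λ a b a′ b′ a″ b″ c →
         (a :* a′ :+ c :* (b :* b′)) :* b″ :+ (a :* b′ :+ b :* a′ :+ b :* b′) :* a″
           :+ (a :* b′ :+ b :* a′ :+ b :* b′) :* b″
      := a :* (a′ :* b″ :+ b′ :* a″ :+ b′ :* b″) :+ b :* (a′ :* a″ :+ c :* (b′ :* b″))
           :+ b :* (a′ :* b″ :+ b′ :* a″ :+ b′ :* b″))
      refl a b a′ b′ a″ b″ c)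

  *′-comm : ∀ x y → x *′ y ≡ y *′ x
  *′-comm (a , b) (a′ , b′) = cong₂ _,_
    (solve 5 (λ a b a′ b′ c → a :* a′ :+ c :* (b :* b′) := a′ :* a :+ c :* (b′ :* b)) refl a b a′ b′ c)
    (solve 4 (λ a b a′ b′ → a :* b′ :+ b :* a′ :+ b :* b′ := a′ :* b :+ b′ :* a :+ b′ :* b) refl a b a′ b′)

  *′-identityˡ : ∀ x → 1′ *′ x ≡ x
  *′-identityˡ (a , b) = cong₂ _,_
    (trans (cong₂ _+_ (*-identityˡ a) (trans (cong (c *_) (zeroˡ b)) (zeroʳ c))) (+-identityʳ a))
    (trans (cong₂ _+_ (trans (cong₂ _+_ (*-identityˡ b) (zeroˡ a)) (+-identityʳ b)) (zeroˡ b)) (+-identityʳ b))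

  *′-distribʳ-+′ : ∀ x y z → (y +′ z) *′ x ≡ (y *′ x) +′ (z *′ x)
  *′-distribʳ-+′ (a , b) (a′ , b′) (a″ , b″) = cong₂ _,_
    (solve 7 (λ a b a′ b′ a″ b″ c →
         (a′ :+ a″) :* a :+ c :* ((b′ :+ b″) :* b)
      := (a′ :* a :+ c :* (b′ :* b)) :+ (a″ :* a :+ c :* (b″ :* b)))
      refl a b a′ b′ a″ b″ c)
    (solve 6 (λ a b a′ b′ a″ b″ →
         (a′ :+ a″) :* b :+ (b′ :+ b″) :* a :+ (b′ :+ b″) :* b
      := (a′ :* b :+ b′ :* a :+ b′ :* b) :+ (a″ :* b :+ b″ :* a :+ b″ :* b))
      refl a b a′ b′ a″ b″)

  *′-zeroʳ : ∀ x → x *′ 0′ ≡ 0′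
  *′-zeroʳ (a , b) = cong₂ _,_
    (trans (cong₂ _+_ (zeroʳ a) (trans (cong (c *_) (zeroʳ b)) (zeroʳ c))) (+-identityˡ 0#))
    (trans (cong₂ _+_ (trans (cong₂ _+_ (zeroʳ a) (zeroʳ b)) (+-identityˡ 0#)) (zeroʳ b)) (+-identityˡ 0#))

  conj : Pair → Pair
  conj (u , v) = (u + v , - v)

  norm : Pair → Carrier
  norm (u , v) = (u + v) * u + c * (- v * v)

  conj-*′ : ∀ x → conj x *′ x ≡ (norm x , 0#)
  conj-*′ (u , v) = cong (norm (u , v) ,_) (begin
    (u + v) * v + - v * u + - v * v   ≡⟨ solve 3 (λ u v -v → (u :+ v) :* v :+ -v :* u :+ -v :* v
                                                        := (v :+ -v) :* (u :+ v)) refl u v (- v) ⟩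
    (v + - v) * (u + v)               ≡⟨ cong (_* (u + v)) (-‿inverseʳ v) ⟩
    0# * (u + v)                      ≡⟨ zeroˡ _ ⟩
    0#                                ∎)
    where open ≡-Reasoning

  scalar-*′ : ∀ s x → (s , 0#) *′ x ≡ (s * proj₁ x , s * proj₂ x)
  scalar-*′ s (a , b) = cong₂ _,_
    (trans (cong (s * a +_) (trans (cong (c *_) (zeroˡ b)) (zeroʳ c))) (+-identityʳ _))
    (trans (cong₂ _+_ (trans (cong (s * b +_) (zeroˡ a)) (+-identityʳ _)) (zeroˡ b)) (+-identityʳ _))

  -- If v ≠ 0, a vanishing norm makes w = u / v a solution of w² + w = c.
  norm≢0 : ∀ x → x ≢ 0′ → norm x ≢ 0#
  norm≢0 (u , v) x≢0 norm≡0 with v ≟ 0#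
  ... | yes refl = x≢0 (cong (_, 0#) u≡0)
    where
    u*u≡0 : u * u ≡ 0#
    u*u≡0 = trans (sym (trans (cong₂ _+_ (cong (_* u) (+-identityʳ u)) (trans (cong (c *_) (zeroʳ (- 0#))) (zeroʳ c)))
                                (+-identityʳ _))) norm≡0
    u≡0 : u ≡ 0#
    u≡0 = [ (λ e → e) , (λ e → e) ]′ (zero-product u*u≡0)
  ... | no v≢0 = w²+w≢c w (x∙y⁻¹≈ε⇒x≈y (w²+w w) c w²+w-c≡0)
    where
    v⁻¹ : Carrier
    v⁻¹ = proj₁ (inverse v≢0)
    v*v⁻¹≡1 : v * v⁻¹ ≡ 1#
    v*v⁻¹≡1 = proj₂ (inverse v≢0)
    w : Carrier
    w = u * v⁻¹
    norm/v² : norm (u , v) * (v⁻¹ * v⁻¹) ≡ w * w + w * (v * v⁻¹) + c * ((- v * v⁻¹) * (v * v⁻¹))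
    norm/v² = solve 5 (λ u v -v v⁻¹ c →
         ((u :+ v) :* u :+ c :* (-v :* v)) :* (v⁻¹ :* v⁻¹)
      := (u :* v⁻¹) :* (u :* v⁻¹) :+ (u :* v⁻¹) :* (v :* v⁻¹) :+ c :* ((-v :* v⁻¹) :* (v :* v⁻¹)))
      refl u v (- v) v⁻¹ c
    -c≡ : c * ((- v * v⁻¹) * (v * v⁻¹)) ≡ - c
    -c≡ = begin
      c * ((- v * v⁻¹) * (v * v⁻¹))  ≡⟨ cong (λ x → c * (x * (v * v⁻¹))) (-‿distribˡ-* v v⁻¹) ⟨
      c * (- (v * v⁻¹) * (v * v⁻¹))  ≡⟨ cong (λ x → c * (- x * x)) v*v⁻¹≡1 ⟩
      c * (- 1# * 1#)                ≡⟨ cong (c *_) (*-identityʳ (- 1#)) ⟩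
      c * - 1#                       ≡⟨ -‿distribʳ-* c 1# ⟨
      - (c * 1#)                     ≡⟨ cong -_ (*-identityʳ c) ⟩
      - c                            ∎
      where open ≡-Reasoning
    w²+w-c≡0 : w²+w w + - c ≡ 0#
    w²+w-c≡0 = begin
      w * w + w + - c                                    ≡⟨ cong₂ (λ x y → w * w + x + y)
                                                              (trans (cong (w *_) v*v⁻¹≡1) (*-identityʳ w)) -c≡ ⟨
      w * w + w * (v * v⁻¹) + c * ((- v * v⁻¹) * (v * v⁻¹)) ≡⟨ norm/v² ⟨
      norm (u , v) * (v⁻¹ * v⁻¹)                         ≡⟨ cong (_* (v⁻¹ * v⁻¹)) norm≡0 ⟩
      0# * (v⁻¹ * v⁻¹)                                   ≡⟨ zeroˡ _ ⟩
      0#                                                 ∎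
      where open ≡-Reasoning

  zero-product′ : ∀ {x y} → x *′ y ≡ 0′ → x ≡ 0′ ⊎ y ≡ 0′
  zero-product′ {x} {y} xy≡0 with ≡-dec _≟_ _≟_ x 0′
  ... | yes x≡0 = inj₁ x≡0
  ... | no x≢0 = inj₂ (cong₂ _,_ (cancel-norm (cong proj₁ norm·y≡0)) (cancel-norm (cong proj₂ norm·y≡0)))
    where
    norm·y≡0 : (norm x * proj₁ y , norm x * proj₂ y) ≡ 0′
    norm·y≡0 = begin
      (norm x * proj₁ y , norm x * proj₂ y)  ≡⟨ scalar-*′ (norm x) y ⟨
      (norm x , 0#) *′ y                     ≡⟨ cong (_*′ y) (conj-*′ x) ⟨
      (conj x *′ x) *′ y                     ≡⟨ *′-assoc (conj x) x y ⟩
      conj x *′ (x *′ y)                     ≡⟨ cong (conj x *′_) xy≡0 ⟩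
      conj x *′ 0′                           ≡⟨ *′-zeroʳ (conj x) ⟩
      0′                                     ∎
      where open ≡-Reasoning
    cancel-norm : ∀ {z} → norm x * z ≡ 0# → z ≡ 0#
    cancel-norm e with zero-product e
    ... | inj₁ norm≡0 = contradiction norm≡0 (norm≢0 x x≢0)
    ... | inj₂ z≡0 = z≡0

  encode′ : Pair → Fin (card Nat.* card)
  encode′ (u , v) = Fin.combine (encode u) (encode v)

  decode′ : Fin (card Nat.* card) → Pair
  decode′ i = Product.map decode decode (Fin.remQuot card i)

  decode′-encode′ : ∀ x → decode′ (encode′ x) ≡ x
  decode′-encode′ (u , v) = trans (cong (Product.map decode decode) (Finₚ.remQuot-combine (encode u) (encode v)))
    (cong₂ _,_ (decode-encode u) (decode-encode v))

  encode′-decode′ : ∀ i → encode′ (decode′ i) ≡ i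
  encode′-decode′ i = trans (cong₂ Fin.combine (encode-decode _) (encode-decode _)) (Finₚ.combine-remQuot {card} card i)

  coord′ : Pair → Fin (dim Nat.+ dim) → ℕ
  coord′ (u , v) l = [ coord u , coord v ]′ (splitAt dim l)

  coord′-+′ : ∀ x y l → coord′ (x +′ y) l ≡ (coord′ x l Nat.+ coord′ y l) % p
  coord′-+′ (u , v) (u′ , v′) l with splitAt dim l
  ... | inj₁ l′ = coord-+ u u′ l′
  ... | inj₂ l′ = coord-+ v v′ l′

  coord′-0′ : ∀ l → coord′ 0′ l ≡ 0
  coord′-0′ l with splitAt dim l
  ... | inj₁ l′ = coord-0# l′
  ... | inj₂ l′ = coord-0# l′

  coord′≡0⇒≡0′ : ∀ x → (∀ l → coord′ x l ≡ 0) → x ≡ 0′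
  coord′≡0⇒≡0′ (u , v) h = cong₂ _,_
    (coord≡0⇒≡0# u λ l → trans (sym (cong [ coord u , coord v ]′ (Finₚ.splitAt-↑ˡ dim l dim))) (h (l ↑ˡ dim)))
    (coord≡0⇒≡0# v λ l → trans (sym (cong [ coord u , coord v ]′ (Finₚ.splitAt-↑ʳ dim dim l))) (h (dim ↑ʳ l)))

  fromBits′ : (Fin (dim Nat.+ dim) → Bool) → Pair
  fromBits′ β = fromBits (β ∘ (_↑ˡ dim)) , fromBits (β ∘ (dim ↑ʳ_))

  coord′-fromBits′ : ∀ β l → coord′ (fromBits′ β) l ≡ bit (β l)
  coord′-fromBits′ β l with splitAt dim l in eq
  ... | inj₁ l′ = trans (coord-fromBits _ l′) (cong (bit ∘ β) (Finₚ.splitAt⁻¹-↑ˡ eq))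
  ... | inj₂ l′ = trans (coord-fromBits _ l′) (cong (bit ∘ β) (Finₚ.splitAt⁻¹-↑ʳ eq))

  extension : CoordField p
  extension = record
    { Carrier = Pair
    ; _≟_ = ≡-dec _≟_ _≟_
    ; _+_ = _+′_
    ; _*_ = _*′_
    ; -_ = -′_
    ; 0# = 0′
    ; 1# = 1′
    ; isCommutativeRing = mkIsCommutativeRing _+′_ _*′_ -′_ 0′ 1′
        +′-assoc +′-comm +′-identityˡ -′-inverseˡ *′-assoc *′-comm *′-identityˡ *′-distribʳ-+′
    ; zero-product = zero-product′
    ; 1≢0 = 1≢0 ∘ cong proj₁
    ; card = card Nat.* card
    ; encode = encode′
    ; decode = decode′
    ; decode-encode = decode′-encode′
    ; encode-decode = encode′-decode′
    ; dim = dim Nat.+ dim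
    ; coord = coord′
    ; coord-+ = coord′-+′
    ; coord-0# = coord′-0′
    ; coord≡0⇒≡0# = coord′≡0⇒≡0′
    ; fromBits = fromBits′
    ; coord-fromBits = coord′-fromBits′
    }

fieldTower : ∀ {p} .{{_ : NonZero p}} → Prime p → ℕ → CoordField p
fieldTower p-prime zero    = IntegersModPrime.coordField _ p-prime
fieldTower p-prime (suc j) = QuadraticExtension.extension (fieldTower p-prime j)

dim-fieldTower : ∀ {p} .{{_ : NonZero p}} (p-prime : Prime p) j → CoordField.dim (fieldTower p-prime j) ≡ 2 Nat.^ j
dim-fieldTower p-prime zero    = refl
dim-fieldTower p-prime (suc j) = trans (cong₂ Nat._+_ (dim-fieldTower p-prime j) (dim-fieldTower p-prime j))
  (cong (2 Nat.^ j Nat.+_) (sym (ℕₚ.+-identityʳ (2 Nat.^ j))))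

-- Polynomial functions

module Polynomials {p : ℕ} .{{_ : NonZero p}} (F : CoordField p) where

  open CoordFieldProperties F
  open import Algebra.Definitions.RawSemiring (Semiring.rawSemiring semiring) public using (_^_)
  module ΣF = Algebra.Properties.Semiring.Sum semiring

  IsMonic : ℕ → (Carrier → Carrier) → Set
  IsMonic zero    f = ∀ s → f s ≡ 1#
  IsMonic (suc D) f = Σ Carrier λ c₀ → Σ (Carrier → Carrier) λ g → IsMonic D g × (∀ s → f s ≡ s * g s + c₀)

  -- f s - f t = (s - t) h s, written without subtraction.
  factor-root : ∀ D f t → IsMonic (suc D) f →
                Σ (Carrier → Carrier) λ h → IsMonic D h × (∀ s → f s + t * h s ≡ s * h s + f t)
  factor-root zero f t (c₀ , g , g≡1 , f≡) = (λ _ → 1#) , (λ _ → refl) , λ s → begin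
    f s + t * 1#              ≡⟨ cong (_+ t * 1#) (trans (f≡ s) (cong (λ z → s * z + c₀) (g≡1 s))) ⟩
    s * 1# + c₀ + t * 1#      ≡⟨ solve 3 (λ s t c₀ → s :* con 1 :+ c₀ :+ t :* con 1 := s :* con 1 :+ (t :* con 1 :+ c₀))
                                   refl s t c₀ ⟩
    s * 1# + (t * 1# + c₀)    ≡⟨ cong (s * 1# +_) (trans (f≡ t) (cong (λ z → t * z + c₀) (g≡1 t))) ⟨
    s * 1# + f t              ∎
    where open ≡-Reasoning
  factor-root (suc D) f t (c₀ , g , g-monic , f≡) with factor-root D g t g-monic
  ... | h , h-monic , g-factored = (λ s → s * h s + g t) , (g t , h , h-monic , λ s → refl) , λ s → begin
    f s + t * (s * h s + g t)              ≡⟨ cong (_+ t * (s * h s + g t)) (f≡ s) ⟩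
    s * g s + c₀ + t * (s * h s + g t)     ≡⟨ solve 6 (λ s t G H Gt c₀ →
                                                 s :* G :+ c₀ :+ t :* (s :* H :+ Gt) := s :* (G :+ t :* H) :+ c₀ :+ t :* Gt)
                                                 refl s t (g s) (h s) (g t) c₀ ⟩
    s * (g s + t * h s) + c₀ + t * g t     ≡⟨ cong (λ z → s * z + c₀ + t * g t) (g-factored s) ⟩
    s * (s * h s + g t) + c₀ + t * g t     ≡⟨ solve 6 (λ s t G H Gt c₀ →
                                                 s :* (s :* H :+ Gt) :+ c₀ :+ t :* Gt := s :* (s :* H :+ Gt) :+ (t :* Gt :+ c₀))
                                                 refl s t (g s) (h s) (g t) c₀ ⟩
    s * (s * h s + g t) + (t * g t + c₀)   ≡⟨ cong (s * (s * h s + g t) +_) (f≡ t) ⟨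
    s * (s * h s + g t) + f t              ∎
    where open ≡-Reasoning

  roots-bound : ∀ D f → IsMonic D f → (ts : List Carrier) → Unique ts → All (λ t → f t ≡ 0#) ts → length ts ≤ D
  roots-bound zero    f f≡1 []       _ _ = Nat.z≤n
  roots-bound zero    f f≡1 (t ∷ ts) _ (ft≡0 ∷ _) = contradiction (trans (sym (f≡1 t)) ft≡0) 1≢0
  roots-bound (suc D) f _   []       _ _ = Nat.z≤n
  roots-bound (suc D) f f-monic (t₁ ∷ ts) (t₁∉ts ∷ ts-unique) (ft₁≡0 ∷ roots) with factor-root D f t₁ f-monic
  ... | h , h-monic , f-factored = Nat.s≤s (roots-bound D h h-monic ts ts-unique (zipWithAll root-of-h (t₁∉ts , roots)))
    where
    root-of-h : ∀ {t} → t₁ ≢ t × f t ≡ 0# → h t ≡ 0#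
    root-of-h {t} (t₁≢t , ft≡0) = *-cancelʳ t₁h≡th t₁≢t
      where
      t₁h≡th : t₁ * h t ≡ t * h t
      t₁h≡th = begin
        t₁ * h t            ≡⟨ +-identityˡ _ ⟨
        0# + t₁ * h t       ≡⟨ cong (_+ t₁ * h t) ft≡0 ⟨
        f t + t₁ * h t      ≡⟨ f-factored t ⟩
        t * h t + f t₁      ≡⟨ cong (t * h t +_) ft₁≡0 ⟩
        t * h t + 0#        ≡⟨ +-identityʳ _ ⟩
        t * h t             ∎
        where open ≡-Reasoning

  select : Bool → Carrier → Carrier
  select b y = if b then y else 0#

  bitPoly : ∀ {n} → Vec Bool n → Carrier → Carrier
  bitPoly x t = ΣF.sum λ i → select (lookup x i) (t ^ toℕ i)

  bitPoly-∷ : ∀ {n} x₀ (xs : Vec Bool n) t → bitPoly (x₀ ∷ xs) t ≡ t * bitPoly xs t + select x₀ 1#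
  bitPoly-∷ {n} x₀ xs t = trans (+-comm _ _) (cong (_+ select x₀ 1#) (begin
    ΣF.sum (λ i → select (lookup xs i) (t * t ^ toℕ i))  ≡⟨ ΣF.sum-cong-≗ (λ i → *-select t (lookup xs i) _) ⟨
    ΣF.sum (λ i → t * select (lookup xs i) (t ^ toℕ i))  ≡⟨ ΣF.*-distribˡ-sum {n} t _ ⟨
    t * bitPoly xs t                                     ∎))
    where
    open ≡-Reasoning
    *-select : ∀ t b y → t * select b y ≡ select b (t * y)
    *-select t true  y = refl
    *-select t false y = zeroʳ t

  bitPoly-allFalse : ∀ {n} (x : Vec Bool n) → (∀ i → lookup x i ≡ false) → ∀ t → bitPoly x t ≡ 0#
  bitPoly-allFalse []        _ t = refl
  bitPoly-allFalse (x₀ ∷ xs) h t = begin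
    bitPoly (x₀ ∷ xs) t                ≡⟨ bitPoly-∷ x₀ xs t ⟩
    t * bitPoly xs t + select x₀ 1#    ≡⟨ cong₂ (λ y b → t * y + select b 1#) (bitPoly-allFalse xs (h ∘ suc) t) (h zero) ⟩
    t * 0# + 0#                        ≡⟨ trans (+-identityʳ _) (zeroʳ t) ⟩
    0#                                 ∎
    where open ≡-Reasoning

  bitPoly-isMonic : ∀ {n} (x : Vec Bool n) → (∃ λ i → lookup x i ≡ true) → ∃ λ D → D < n × IsMonic D (bitPoly x)
  bitPoly-isMonic (x₀ ∷ xs) (i , xᵢ≡true) with Finₚ.any? (λ i → lookup xs i ≟ᵇ true)
  ... | yes xs-hasTrue =
    let D , D<n , xs-monic = bitPoly-isMonic xs xs-hasTrue
    in suc D , Nat.s≤s D<n , select x₀ 1# , bitPoly xs , xs-monic , bitPoly-∷ x₀ xs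
  ... | no xs-noTrue = 0 , Nat.s≤s Nat.z≤n , λ t → begin
    bitPoly (x₀ ∷ xs) t                ≡⟨ bitPoly-∷ x₀ xs t ⟩
    t * bitPoly xs t + select x₀ 1#    ≡⟨ cong₂ (λ y b → t * y + select b 1#) (bitPoly-allFalse xs xs-allFalse t) x₀≡true ⟩
    t * 0# + 1#                        ≡⟨ trans (cong (_+ 1#) (zeroʳ t)) (+-identityˡ 1#) ⟩
    1#                                 ∎
    where
    open ≡-Reasoning
    xs-allFalse : ∀ j → lookup xs j ≡ false
    xs-allFalse j with lookup xs j in eq
    ... | true  = contradiction (j , eq) xs-noTrue
    ... | false = refl
    x₀≡true : x₀ ≡ true
    x₀≡true = head-true i xᵢ≡true
      where
      head-true : ∀ i → lookup (x₀ ∷ xs) i ≡ true → x₀ ≡ true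
      head-true zero    h = h
      head-true (suc j) h = contradiction (j , h) xs-noTrue

  coord-sum : ∀ {n} (f : Fin n → Carrier) l → coord (ΣF.sum f) l ≡ Σℕ.sum (λ i → coord (f i) l) % p
  coord-sum {zero}  f l = trans (coord-0# l) (sym (m<n⇒m%n≡m (Nat.>-nonZero⁻¹ p)))
  coord-sum {suc n} f l = begin
    coord (f zero + ΣF.sum (f ∘ suc)) l                               ≡⟨ coord-+ _ _ l ⟩
    (coord (f zero) l Nat.+ coord (ΣF.sum (f ∘ suc)) l) % p           ≡⟨ cong (λ x → (coord (f zero) l Nat.+ x) % p)
                                                                           (coord-sum (f ∘ suc) l) ⟩
    (coord (f zero) l Nat.+ Σℕ.sum (λ i → coord (f (suc i)) l) % p) % p ≡⟨ [m+n%d]%d≡[m+n]%d _ _ p ⟩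
    Σℕ.sum (λ i → coord (f i) l) % p                                  ∎
    where open ≡-Reasoning

  coord-bitPoly : ∀ {n} (x : Vec Bool n) t l →
                  coord (bitPoly x t) l ≡ Σℕ.sum (λ i → bit (lookup x i) Nat.* coord (t ^ toℕ i) l) % p
  coord-bitPoly {n} x t l = trans (coord-sum {n} _ l) (cong (_% p) (Σℕ.sum-cong-≗ {n} λ i → coord-select (lookup x i) _))
    where
    coord-select : ∀ b y → coord (select b y) l ≡ bit b Nat.* coord y l
    coord-select true  y = sym (ℕₚ.+-identityʳ _)
    coord-select false y = coord-0# l

-- The OR gadget

module ORGadget (p q : ℕ) .{{_ : NonZero p}} .{{_ : NonZero q}} where

  open Nat using (_+_; _*_; _^_; _≡ᵇ_)

  -- Residue 0 has weight 1, yet the weights of all residues mod p add up to q.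
  weight : ℕ → ℕ
  weight v = bit (v ≡ᵇ 0) + (q ∸ 1) * bit (v ≡ᵇ 1)

  weight-total : ∀ {m} → 1 < m → Σℕ.sum {m} (weight ∘ toℕ) ≡ q
  weight-total {suc zero}    (Nat.s≤s ())
  weight-total {suc (suc m)} _ = begin
    1 + (q ∸ 1) * 0 + ((q ∸ 1) * 1 + Σℕ.sum {m} (λ _ → (q ∸ 1) * 0))
      ≡⟨ cong₂ (λ x y → 1 + x + ((q ∸ 1) * 1 + y)) (ℕₚ.*-zeroʳ (q ∸ 1))
               (trans (Σℕ.sum-cong-≗ {m} (λ _ → ℕₚ.*-zeroʳ (q ∸ 1))) (trans (sum-const m 0) (ℕₚ.*-zeroʳ m))) ⟩
    1 + 0 + ((q ∸ 1) * 1 + 0)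
      ≡⟨ cong suc (trans (ℕₚ.+-identityʳ _) (ℕₚ.*-identityʳ _)) ⟩
    suc (q ∸ 1)
      ≡⟨ ℕₚ.suc-pred q ⟩
    q ∎
    where open ≡-Reasoning

  -- orSum k y c = ∑_{a ∈ F_p^k} weight ((c + a · y) mod p)
  orSum : ∀ k → Vec ℕ k → ℕ → ℕ
  orSum zero    []       c = weight (c % p)
  orSum (suc k) (y₀ ∷ y) c = Σℕ.sum {p} λ a → orSum k y (c + toℕ a * y₀)

  AllVanish : ∀ {k} → Vec ℕ k → Set
  AllVanish y = ∀ j → lookup y j % p ≡ 0

  orSum-allVanish : ∀ k (y : Vec ℕ k) c → AllVanish y → orSum k y c ≡ p ^ k * weight (c % p)
  orSum-allVanish zero    []       c _ = sym (ℕₚ.+-identityʳ _)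
  orSum-allVanish (suc k) (y₀ ∷ y) c vanish = begin
    Σℕ.sum {p} (λ a → orSum k y (c + toℕ a * y₀))  ≡⟨ Σℕ.sum-cong-≗ {p} (λ a → trans (orSum-allVanish k y _ (vanish ∘ suc))
                                                        (cong (λ z → p ^ k * weight z) (shift a))) ⟩
    Σℕ.sum {p} (λ _ → p ^ k * weight (c % p))      ≡⟨ sum-const p _ ⟩
    p * (p ^ k * weight (c % p))                   ≡⟨ ℕₚ.*-assoc p (p ^ k) _ ⟨
    p ^ suc k * weight (c % p)                     ∎
    where
    open ≡-Reasoning
    shift : ∀ a → (c + toℕ a * y₀) % p ≡ c % p
    shift a = %-remove-+ʳ c (∣n⇒∣m*n (toℕ a) (m%n≡0⇒n∣m y₀ p (vanish zero)))

  module _ (p-prime : Prime p) where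

    open IntegersModPrime p p-prime using (1<p; [_]; []-cong; toℕ-[]; toℕ[0]; absorb-+ˡ; absorb-*ʳ)
    module 𝔽 = CoordFieldProperties (IntegersModPrime.coordField p p-prime)

    affine : ℕ → ℕ → Fin p → Fin p
    affine c y₀ a = [ c + toℕ a * y₀ ]

    affine≡ : ∀ c y₀ a → affine c y₀ a ≡ [ c ] 𝔽.+ a 𝔽.* [ y₀ ]
    affine≡ c y₀ a = []-cong (begin
      (c + toℕ a * y₀) % p                          ≡⟨ [m+n%d]%d≡[m+n]%d c _ p ⟨
      (c + (toℕ a * y₀) % p) % p                    ≡⟨ cong (λ x → (c + x) % p) (absorb-*ʳ (toℕ a) y₀) ⟨
      (c + (toℕ a * toℕ [ y₀ ]) % p) % p            ≡⟨ cong (λ x → (c + x) % p) (toℕ-[] _) ⟨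
      (c + toℕ (a 𝔽.* [ y₀ ])) % p                  ≡⟨ absorb-+ˡ c _ ⟨
      (toℕ [ c ] + toℕ (a 𝔽.* [ y₀ ])) % p          ∎)
      where open ≡-Reasoning

    affine-injective : ∀ c y₀ → ¬ (y₀ % p ≡ 0) → Injective (affine c y₀)
    affine-injective c y₀ y₀≢0 {a} {b} eq with a 𝔽.≟ b
    ... | yes a≡b = a≡b
    ... | no  a≢b = contradiction (trans (sym (toℕ-[] y₀)) (trans (cong toℕ Y≡0) toℕ[0])) y₀≢0
      where
      Y≡0 : [ y₀ ] ≡ [ 0 ]
      Y≡0 = 𝔽.*-cancelʳ (𝔽.+-cancelˡ [ c ] _ _ (trans (sym (affine≡ c y₀ a)) (trans eq (affine≡ c y₀ b)))) a≢b

    -- At the first coordinate y₀ after which all vanish, a ↦ c + a·y₀ permutes F_p, so the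
    -- weights add up to q.
    orSum-¬allVanish : ∀ k (y : Vec ℕ k) c → ¬ AllVanish y → q ∣ orSum k y c
    orSum-¬allVanish zero    []       c ¬vanish = contradiction (λ ()) ¬vanish
    orSum-¬allVanish (suc k) (y₀ ∷ y) c ¬vanish with Finₚ.all? (λ j → lookup y j % p Nat.≟ 0)
    ... | no ¬vanish-y = ∣-sum {n = p} (λ a → orSum-¬allVanish k y _ ¬vanish-y)
    ... | yes vanish-y = subst (q ∣_) (sym (begin
      Σℕ.sum {p} (λ a → orSum k y (c + toℕ a * y₀))           ≡⟨ Σℕ.sum-cong-≗ {p} (λ a → orSum-allVanish k y _ vanish-y) ⟩
      Σℕ.sum {p} (λ a → p ^ k * weight ((c + toℕ a * y₀) % p)) ≡⟨ Σℕ.*-distribˡ-sum {p} (p ^ k) _ ⟨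
      p ^ k * Σℕ.sum {p} (λ a → weight ((c + toℕ a * y₀) % p)) ≡⟨ cong (p ^ k *_) (Σℕ.sum-cong-≗ {p} (λ a → cong weight (toℕ-[] _))) ⟨
      p ^ k * Σℕ.sum {p} (weight ∘ toℕ ∘ affine c y₀)          ≡⟨ cong (p ^ k *_) (sum-reindex _ (affine-injective c y₀ y₀≢0) _) ⟨
      p ^ k * Σℕ.sum {p} (weight ∘ toℕ)                        ≡⟨ cong (p ^ k *_) (weight-total 1<p) ⟩
      p ^ k * q                                                ∎)) (n∣m*n (p ^ k))
      where
      open ≡-Reasoning
      y₀≢0 : ¬ (y₀ % p ≡ 0)
      y₀≢0 y₀≡0 = ¬vanish λ { zero → y₀≡0 ; (suc j) → vanish-y j }

-- Depth-2 circuits of MOD gates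

vecSum-tabulate : ∀ {n} (f : Fin n → ℕ) → Vec.sum (tabulate f) ≡ Σℕ.sum f
vecSum-tabulate {zero}  f = refl
vecSum-tabulate {suc n} f = cong (f zero Nat.+_) (vecSum-tabulate (f ∘ suc))

wsum-scaled : ∀ {k} (w : Fin k → ℕ) u (x : Vec Bool k) →
              wsum (λ i → w i Nat.* u) x ≡ Σℕ.sum (λ i → w i Nat.* bit (lookup x i)) Nat.* u
wsum-scaled {k} w u x = begin
  Vec.sum (tabulate (λ i → w i Nat.* u Nat.* bit (lookup x i)))  ≡⟨ vecSum-tabulate {k} _ ⟩
  Σℕ.sum (λ i → w i Nat.* u Nat.* bit (lookup x i))              ≡⟨ Σℕ.sum-cong-≗ {k} (λ i → swap (w i) (bit (lookup x i))) ⟩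
  Σℕ.sum (λ i → w i Nat.* bit (lookup x i) Nat.* u)              ≡⟨ Σℕ.*-distribʳ-sum {k} u _ ⟨
  Σℕ.sum (λ i → w i Nat.* bit (lookup x i)) Nat.* u              ∎
  where
  open ≡-Reasoning
  swap : ∀ a b → a Nat.* u Nat.* b ≡ a Nat.* b Nat.* u
  swap a b = trans (ℕₚ.*-assoc a u b) (trans (cong (a Nat.*_) (ℕₚ.*-comm u b)) (sym (ℕₚ.*-assoc a b u)))

-- A MOD_{d·u} gate whose input wires all have multiplicity divisible by u acts as a MOD_d gate.
scaled-mod : ∀ L d u .{{_ : NonZero d}} .{{_ : NonZero u}} .{{_ : NonZero (d Nat.* u)}} →
             toℕ ((L Nat.* u) mod (d Nat.* u)) Nat./ u ≡ L % d
scaled-mod L d u = begin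
  toℕ ((L Nat.* u) mod (d Nat.* u)) Nat./ u  ≡⟨ cong (Nat._/ u) (Finₚ.toℕ-fromℕ< _) ⟩
  (L Nat.* u) % (d Nat.* u) Nat./ u          ≡⟨ cong (Nat._/ u) (m%n*o≡m*o%[n*o] L d u) ⟨
  L % d Nat.* u Nat./ u                      ≡⟨ m*n/n≡m (L % d) u ⟩
  L % d                                      ∎
  where open ≡-Reasoning

module ModGateCircuits (p q u₁ u₂ : ℕ) .{{_ : NonZero p}} .{{_ : NonZero q}} .{{_ : NonZero u₁}} .{{_ : NonZero u₂}}
                       (m : ℕ) where

  open Nat using (_+_; _*_; _/_; _≡ᵇ_)

  linear : (Fin m → ℕ) → Vec Bool m → ℕ
  linear w x = Σℕ.sum λ i → w i * bit (lookup x i)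

  record Form : Set where
    constructor form
    field
      const : ℕ
      coeff : Fin m → ℕ
  open Form public

  value : Form → Vec Bool m → ℕ
  value f x = const f + linear (coeff f) x

  zeroForm : Form
  zeroForm = form 0 λ _ → 0

  value-zeroForm : ∀ x → value zeroForm x ≡ 0
  value-zeroForm x = trans (Σℕ.sum-cong-≗ {m} (λ i → refl)) (Σℕ.sum-replicate-zero m)

  infixl 6 _+[_]·_
  _+[_]·_ : Form → ℕ → Form → Form
  f +[ k ]· g = form (const f + k * const g) λ i → coeff f i + k * coeff g i

  value-+· : ∀ f k g x → value (f +[ k ]· g) x ≡ value f x + k * value g x
  value-+· f k g x = begin
    const f + k * const g + linear (λ i → coeff f i + k * coeff g i) x
      ≡⟨ cong (const f + k * const g +_) (begin
           Σℕ.sum (λ i → (coeff f i + k * coeff g i) * bit (lookup x i))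
             ≡⟨ Σℕ.sum-cong-≗ {m} (λ i → distrib (coeff f i) (coeff g i) (bit (lookup x i))) ⟩
           Σℕ.sum (λ i → coeff f i * bit (lookup x i) + k * (coeff g i * bit (lookup x i)))
             ≡⟨ Σℕ.∑-distrib-+ {m} _ _ ⟩
           linear (coeff f) x + Σℕ.sum (λ i → k * (coeff g i * bit (lookup x i)))
             ≡⟨ cong (linear (coeff f) x +_) (Σℕ.*-distribˡ-sum {m} k _) ⟨
           linear (coeff f) x + k * linear (coeff g) x ∎) ⟩
    const f + k * const g + (linear (coeff f) x + k * linear (coeff g) x)
      ≡⟨ solve 5 (λ c k c′ L L′ → c :+ k :* c′ :+ (L :+ k :* L′) := c :+ L :+ k :* (c′ :+ L′))
                 refl (const f) k (const g) (linear (coeff f) x) (linear (coeff g) x) ⟩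
    value f x + k * value g x ∎
    where
    open ≡-Reasoning
    open +-*-Solver
    distrib : ∀ a b c → (a + k * b) * c ≡ a * c + k * (b * c)
    distrib a b c = solve 4 (λ a b c k → (a :+ k :* b) :* c := a :* c :+ k :* (b :* c)) refl a b c k

  -- A level-1 MOD_p gate testing test ≡ residue (mod p), wired into the output gate `wire` times.
  record Gate : Set where
    constructor gate
    field
      test : Form
      residue : ℕ
      wire : ℕ
  open Gate public

  fires : Gate → Vec Bool m → Bool
  fires g x = value (test g) x % p ≡ᵇ residue g

  contribution : Vec Bool m → Gate → ℕ
  contribution x g = wire g * bit (fires g x)

  -- The constant of each form is absorbed into the accepting set of its gate.
  circuit : List Gate → ℕ → Circuit2 (p * u₁) (q * u₂) m
  circuit gs P = record
    { s  = length gs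
    ; A₁ = λ j v → (toℕ v / u₁ + const (test (List.lookup gs j))) % p ≡ᵇ residue (List.lookup gs j)
    ; w₁ = λ j i → coeff (test (List.lookup gs j)) i * u₁
    ; A₂ = λ v → toℕ v / u₂ ≡ᵇ P % q
    ; w₂ = λ j → wire (List.lookup gs j) * u₂
    }

  level₁ : ∀ gs P x j → modGate (p * u₁) (A₁ (circuit gs P) j) (wsum (w₁ (circuit gs P) j) x) ≡ fires (List.lookup gs j) x
  level₁ gs P x j = cong (_≡ᵇ residue (List.lookup gs j)) (begin
    (toℕ (wsum (λ i → coeff f i * u₁) x mod (p * u₁)) / u₁ + const f) % p
      ≡⟨ cong (λ v → (toℕ (v mod (p * u₁)) / u₁ + const f) % p) (wsum-scaled (coeff f) u₁ x) ⟩
    (toℕ ((linear (coeff f) x * u₁) mod (p * u₁)) / u₁ + const f) % p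
      ≡⟨ cong (λ v → (v + const f) % p) (scaled-mod (linear (coeff f) x) p u₁) ⟩
    (linear (coeff f) x % p + const f) % p
      ≡⟨ [m%d+n]%d≡[m+n]%d _ _ p ⟩
    (linear (coeff f) x + const f) % p
      ≡⟨ cong (_% p) (ℕₚ.+-comm (linear (coeff f) x) (const f)) ⟩
    value f x % p ∎)
    where
    open ≡-Reasoning
    f : Form
    f = test (List.lookup gs j)

  eval-circuit : ∀ gs P x → eval (circuit gs P) x ≡ (sum (map (contribution x) gs) % q ≡ᵇ P % q)
  eval-circuit gs P x = cong (_≡ᵇ P % q) (begin
    toℕ (wsum (λ j → wire (List.lookup gs j) * u₂) outputs mod (q * u₂)) / u₂
      ≡⟨ cong (λ v → toℕ (v mod (q * u₂)) / u₂) (wsum-scaled (wire ∘ List.lookup gs) u₂ outputs) ⟩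
    toℕ ((linear′ * u₂) mod (q * u₂)) / u₂
      ≡⟨ scaled-mod linear′ q u₂ ⟩
    linear′ % q
      ≡⟨ cong (_% q) (Σℕ.sum-cong-≗ {length gs} λ j → cong (λ b → wire (List.lookup gs j) * bit b)
           (trans (Vecₚ.lookup∘tabulate _ j) (level₁ gs P x j))) ⟩
    Σℕ.sum (contribution x ∘ List.lookup gs) % q
      ≡⟨ cong (_% q) (sum-map-lookup (contribution x) gs) ⟩
    sum (map (contribution x) gs) % q ∎)
    where
    open ≡-Reasoning
    outputs : Vec Bool (length gs)
    outputs = tabulate λ j → modGate (p * u₁) (A₁ (circuit gs P) j) (wsum (w₁ (circuit gs P) j) x)
    linear′ : ℕ
    linear′ = Σℕ.sum λ j → wire (List.lookup gs j) * bit (lookup outputs j)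

  open ORGadget p q using (orSum)

  orGates : ∀ k → Vec Form k → Form → List Gate
  orGates zero    []       acc = gate acc 0 1 ∷ gate acc 1 (q ∸ 1) ∷ []
  orGates (suc k) (y₀ ∷ ys) acc = concatMap (λ a → orGates k ys (acc +[ toℕ a ]· y₀)) (allFin p)

  sum-contribution-orGates : ∀ k ys acc x →
    sum (map (contribution x) (orGates k ys acc)) ≡ orSum k (Vec.map (λ f → value f x) ys) (value acc x)
  sum-contribution-orGates zero    []        acc x =
    cong₂ _+_ (ℕₚ.*-identityˡ (bit (value acc x % p ≡ᵇ 0))) (ℕₚ.+-identityʳ ((q ∸ 1) * bit (value acc x % p ≡ᵇ 1)))
  sum-contribution-orGates (suc k) (y₀ ∷ ys) acc x = begin
    sum (map (contribution x) (concatMap branch (allFin p)))               ≡⟨ sum-map-concatMap branch (contribution x) (allFin p) ⟩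
    sum (map (λ a → sum (map (contribution x) (branch a))) (allFin p))     ≡⟨ sum-map-allFin {p} _ ⟩
    Σℕ.sum (λ a → sum (map (contribution x) (branch a)))                   ≡⟨ Σℕ.sum-cong-≗ {p} (λ a →
                                                                                trans (sum-contribution-orGates k ys _ x)
                                                                                      (cong (orSum k _) (value-+· acc (toℕ a) y₀ x))) ⟩
    orSum (suc k) (Vec.map (λ f → value f x) (y₀ ∷ ys)) (value acc x)      ∎
    where
    open ≡-Reasoning
    branch : Fin p → List Gate
    branch a = orGates k ys (acc +[ toℕ a ]· y₀)

  length-orGates : ∀ k ys acc → length (orGates k ys acc) ≡ 2 * p Nat.^ k
  length-orGates zero    []        acc = refl
  length-orGates (suc k) (y₀ ∷ ys) acc = begin
    length (concatMap branch (allFin p))              ≡⟨ length-concatMap branch (allFin p) ⟩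
    sum (map (length ∘ branch) (allFin p))            ≡⟨ sum-map-allFin {p} _ ⟩
    Σℕ.sum (length ∘ branch)                          ≡⟨ Σℕ.sum-cong-≗ {p} (λ a → length-orGates k ys _) ⟩
    Σℕ.sum {p} (λ _ → 2 * p Nat.^ k)                  ≡⟨ sum-const p _ ⟩
    p * (2 * p Nat.^ k)                               ≡⟨ ℕₚ.*-comm p _ ⟩
    2 * p Nat.^ k * p                                 ≡⟨ ℕₚ.*-assoc 2 (p Nat.^ k) p ⟩
    2 * (p Nat.^ k * p)                               ≡⟨ cong (2 *_) (ℕₚ.*-comm (p Nat.^ k) p) ⟩
    2 * p Nat.^ suc k                                 ∎
    where
    open ≡-Reasoning
    branch : Fin p → List Gate
    branch a = orGates k ys (acc +[ toℕ a ]· y₀)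

-- The probabilistic circuit for AND

module BitVectors where

  open Nat using (_+_; _*_; _^_)

  infix 4 _≟ᵛ_
  _≟ᵛ_ : ∀ {r} → DecidableEquality (Vec Bool r)
  _≟ᵛ_ = Vecₚ.≡-dec _≟ᵇ_

  indicator : ∀ {r} → Vec Bool r → ℕ → Vec Bool r → ℕ
  indicator b R β = if does (β ≟ᵛ b) then R else 0

  doubling : ∀ {r} → Vec Bool r → List (Vec Bool (suc r))
  doubling v = (false ∷ v) ∷ (true ∷ v) ∷ []

  length-allVecs : ∀ r → length (allVecs r) ≡ 2 ^ r
  length-allVecs zero    = refl
  length-allVecs (suc r) = begin
    length (concatMap doubling (allVecs r))        ≡⟨ length-concatMap doubling (allVecs r) ⟩
    sum (map (λ _ → 2) (allVecs r))                ≡⟨ sum-map-const (allVecs r) 2 ⟩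
    length (allVecs r) * 2                         ≡⟨ cong (_* 2) (length-allVecs r) ⟩
    2 ^ r * 2                                      ≡⟨ ℕₚ.*-comm (2 ^ r) 2 ⟩
    2 ^ suc r                                      ∎
    where open ≡-Reasoning

  sum-indicator-allVecs : ∀ r (b : Vec Bool r) R → sum (map (indicator b R) (allVecs r)) ≡ R
  sum-indicator-allVecs zero    []       R = ℕₚ.+-identityʳ R
  sum-indicator-allVecs (suc r) (b₀ ∷ b) R = begin
    sum (map (indicator (b₀ ∷ b) R) (concatMap doubling (allVecs r)))
      ≡⟨ sum-map-concatMap doubling (indicator (b₀ ∷ b) R) (allVecs r) ⟩
    sum (map (λ v → sum (map (indicator (b₀ ∷ b) R) (doubling v))) (allVecs r))
      ≡⟨ cong sum (Listₚ.map-cong (pair b₀) (allVecs r)) ⟩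
    sum (map (indicator b R) (allVecs r))
      ≡⟨ sum-indicator-allVecs r b R ⟩
    R ∎
    where
    open ≡-Reasoning
    pair : ∀ b₀ v → sum (map (indicator (b₀ ∷ b) R) (doubling v)) ≡ indicator b R v
    pair false v with does (v ≟ᵛ b)
    ... | true  = ℕₚ.+-identityʳ R
    ... | false = refl
    pair true  v with does (v ≟ᵛ b)
    ... | true  = ℕₚ.+-identityʳ R
    ... | false = refl

  count : ∀ {r} → Vec Bool r → List (Vec Bool r) → ℕ
  count b = sum ∘ map (indicator b 1)

  count≡0⇒∉ : ∀ {r} (b : Vec Bool r) xs → count b xs ≡ 0 → All (b ≢_) xs
  count≡0⇒∉ b []       _ = []
  count≡0⇒∉ b (x ∷ xs) c≡0 with x ≟ᵛ b
  ... | yes _   = contradiction c≡0 λ ()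
  ... | no  x≢b = (λ b≡x → x≢b (sym b≡x)) ∷ count≡0⇒∉ b xs c≡0

  count≤1⇒unique : ∀ {r} (xs : List (Vec Bool r)) → (∀ b → count b xs ≤ 1) → Unique xs
  count≤1⇒unique []       _ = []
  count≤1⇒unique (x ∷ xs) count≤1 =
    count≡0⇒∉ x xs (ℕₚ.n≤0⇒n≡0 (ℕₚ.+-cancelˡ-≤ 1 _ _ (subst (λ c → c + count x xs ≤ 1) (head-count x) (count≤1 x))))
    ∷ count≤1⇒unique xs (λ b → ℕₚ.≤-trans (ℕₚ.m≤n+m (count b xs) _) (count≤1 b))
    where
    head-count : ∀ x → indicator x 1 x ≡ 1
    head-count x = cong (λ d → if d then 1 else 0) (dec-true (x ≟ᵛ x) refl)

  allVecs-unique : ∀ r → Unique (allVecs r)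
  allVecs-unique r = count≤1⇒unique (allVecs r) λ b → ℕₚ.≤-reflexive (sum-indicator-allVecs r b 1)

AND≡true⇒ : ∀ {n} (a : Vec Bool n) → AND a ≡ true → ∀ i → lookup a i ≡ true
AND≡true⇒ (true ∷ a) h zero    = refl
AND≡true⇒ (true ∷ a) h (suc i) = AND≡true⇒ a h i

AND≡false⇒ : ∀ {n} (a : Vec Bool n) → AND a ≡ false → ∃ λ i → lookup a i ≡ false
AND≡false⇒ (false ∷ a) _ = zero , refl
AND≡false⇒ (true  ∷ a) h = let i , aᵢ≡false = AND≡false⇒ a h in suc i , aᵢ≡false

two-thirds : ∀ {N good bad n} → good Nat.+ bad ≡ N → bad < n → 3 Nat.* n ≤ N → 2 Nat.* N ≤ 3 Nat.* good
two-thirds {N} {good} {bad} {n} good+bad≡N bad<n 3n≤N = begin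
  2 * N                    ≡⟨ cong (2 *_) good+bad≡N ⟨
  2 * (good + bad)         ≡⟨ ℕₚ.*-distribˡ-+ 2 good bad ⟩
  2 * good + 2 * bad       ≤⟨ ℕₚ.+-monoʳ-≤ (2 * good) 2bad≤good ⟩
  2 * good + good          ≡⟨ solve 1 (λ g → con 2 :* g :+ g := con 3 :* g) refl good ⟩
  3 * good                 ∎
  where
  open Nat using (_+_; _*_)
  open ℕₚ.≤-Reasoning
  open +-*-Solver
  2bad≤good : 2 * bad ≤ good
  2bad≤good = ℕₚ.+-cancelʳ-≤ bad (2 * bad) good (ℕₚ.≤-trans
    (ℕₚ.≤-reflexive (solve 1 (λ b → con 2 :* b :+ b := con 3 :* b) refl bad))
    (ℕₚ.≤-trans (ℕₚ.*-monoʳ-≤ 3 (ℕₚ.<⇒≤ bad<n)) (ℕₚ.≤-trans 3n≤N (ℕₚ.≤-reflexive (sym good+bad≡N)))))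

prime∤prime^ : ∀ {p q} → Prime p → Prime q → p ≢ q → ∀ k → ¬ (q ∣ p Nat.^ k)
prime∤prime^ p-prime q-prime p≢q zero q∣1 = ¬prime[1] (subst Prime (∣1⇒≡1 q∣1) q-prime)
prime∤prime^ p-prime q-prime p≢q (suc k) q∣p^k+1 with euclidsLemma _ _ q-prime q∣p^k+1
... | inj₂ q∣p^k = prime∤prime^ p-prime q-prime p≢q k q∣p^k
... | inj₁ q∣p with prime⇒irreducible p-prime q∣p
...   | inj₁ q≡1 = ¬prime[1] (subst Prime q≡1 q-prime)
...   | inj₂ q≡p = p≢q (sym q≡p)

module RandomisedAND (p q u₁ u₂ : ℕ) .{{_ : NonZero p}} .{{_ : NonZero q}} .{{_ : NonZero u₁}} .{{_ : NonZero u₂}}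
                     (p-prime : Prime p) (q-prime : Prime q) (p≢q : p ≢ q) (J n : ℕ) where

  open Nat using (_+_; _*_; _^_; _≡ᵇ_)
  open BitVectors

  F : CoordField p
  F = fieldTower p-prime J

  open CoordFieldProperties F using (Carrier; _≟_; 0#; dim; coord; coord-0#; coord≡0⇒≡0#; fromBits; coord-fromBits)
  open Polynomials F using (bitPoly; coord-bitPoly; bitPoly-allFalse; bitPoly-isMonic; roots-bound) renaming (_^_ to _^ᶠ_)

  r : ℕ
  r = dim

  open ModGateCircuits p q u₁ u₂ (n + r)
  open ORGadget p q using (AllVanish; orSum-allVanish; orSum-¬allVanish)

  randomPoint : Vec Bool r → Carrier
  randomPoint β = fromBits (lookup β)

  zeros : Vec Bool n → Vec Bool n
  zeros = Vec.map not

  Root : Vec Bool n → Vec Bool r → Set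
  Root a β = bitPoly (zeros a) (randomPoint β) ≡ 0#

  root? : ∀ a β → Dec (Root a β)
  root? a β = bitPoly (zeros a) (randomPoint β) ≟ 0#

  split : (Fin n → ℕ) → (Fin r → ℕ) → Fin (n + r) → ℕ
  split f g = [ f , g ]′ ∘ splitAt n

  linear-split : ∀ f g a b →
    linear (split f g) (a ++ b) ≡ Σℕ.sum (λ i → f i * bit (lookup a i)) + Σℕ.sum (λ j → g j * bit (lookup b j))
  linear-split f g a b = trans (sum-↑ {n} {r} _) (cong₂ _+_
    (Σℕ.sum-cong-≗ {n} λ i → cong₂ (λ s v → [ f , g ]′ s * bit v) (Finₚ.splitAt-↑ˡ n i r) (Vecₚ.lookup-++ˡ a b i))
    (Σℕ.sum-cong-≗ {r} λ j → cong₂ (λ s v → [ f , g ]′ s * bit v) (Finₚ.splitAt-↑ʳ n r j) (Vecₚ.lookup-++ʳ a b j)))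

  powerCoord : Vec Bool r → Fin r → Fin n → ℕ
  powerCoord β ℓ i = coord (randomPoint β ^ᶠ toℕ i) ℓ

  -- ∑ᵢ (1 - aᵢ) Kᵢ with 1 - aᵢ encoded as 1 + (p - 1) aᵢ, so that all coefficients are natural numbers.
  coordForm : Vec Bool r → Fin r → Form
  coordForm β ℓ = form (Σℕ.sum (powerCoord β ℓ)) (split (λ i → (p ∸ 1) * powerCoord β ℓ i) (λ _ → 0))

  value-coordForm : ∀ β ℓ a b → value (coordForm β ℓ) (a ++ b) % p ≡ coord (bitPoly (zeros a) (randomPoint β)) ℓ
  value-coordForm β ℓ a b = begin
    (Σℕ.sum K + linear (split (λ i → (p ∸ 1) * K i) (λ _ → 0)) (a ++ b)) % p
      ≡⟨ cong (λ v → (Σℕ.sum K + v) % p) (trans (linear-split _ _ a b)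
           (trans (cong (Σℕ.sum (λ i → (p ∸ 1) * K i * bit (lookup a i)) +_) (Σℕ.sum-replicate-zero r)) (ℕₚ.+-identityʳ _))) ⟩
    (Σℕ.sum K + Σℕ.sum (λ i → (p ∸ 1) * K i * bit (lookup a i))) % p
      ≡⟨ cong (_% p) (Σℕ.∑-distrib-+ {n} K _) ⟨
    Σℕ.sum (λ i → K i + (p ∸ 1) * K i * bit (lookup a i)) % p
      ≡⟨ cong (_% p) (Σℕ.sum-cong-≗ {n} λ i → complement (K i) (lookup a i)) ⟩
    Σℕ.sum (λ i → bit (not (lookup a i)) * K i + p * (K i * bit (lookup a i))) % p
      ≡⟨ cong (_% p) (trans (Σℕ.∑-distrib-+ {n} _ _) (cong (Σℕ.sum (λ i → bit (not (lookup a i)) * K i) +_) (sym (Σℕ.*-distribˡ-sum {n} p _)))) ⟩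
    (Σℕ.sum (λ i → bit (not (lookup a i)) * K i) + p * Σℕ.sum (λ i → K i * bit (lookup a i))) % p
      ≡⟨ %-remove-+ʳ _ (m∣m*n _) ⟩
    Σℕ.sum (λ i → bit (not (lookup a i)) * K i) % p
      ≡⟨ cong (_% p) (Σℕ.sum-cong-≗ {n} λ i → cong (λ v → bit v * K i) (Vecₚ.lookup-map i not a)) ⟨
    Σℕ.sum (λ i → bit (lookup (zeros a) i) * K i) % p
      ≡⟨ coord-bitPoly (zeros a) (randomPoint β) ℓ ⟨
    coord (bitPoly (zeros a) (randomPoint β)) ℓ ∎
    where
    open ≡-Reasoning
    K : Fin n → ℕ
    K = powerCoord β ℓ
    complement : ∀ k v → k + (p ∸ 1) * k * bit v ≡ bit (not v) * k + p * (k * bit v)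
    complement k false = trans (cong (k +_) (ℕₚ.*-zeroʳ ((p ∸ 1) * k)))
      (sym (cong₂ _+_ (ℕₚ.+-identityʳ k) (trans (cong (p *_) (ℕₚ.*-zeroʳ k)) (ℕₚ.*-zeroʳ p))))
    complement k true  = trans (cong (k +_) (ℕₚ.*-identityʳ _))
      (trans (cong (_* k) (ℕₚ.suc-pred p)) (cong (p *_) (sym (ℕₚ.*-identityʳ k))))

  unit : Fin r → ℕ → Fin r → ℕ
  unit ℓ w j = if does (j Finₚ.≟ ℓ) then w else 0

  bitForm : Vec Bool r → Fin r → Form
  bitForm β ℓ = if lookup β ℓ then form 1 (split (λ _ → 0) (unit ℓ (p ∸ 1)))
                              else form 0 (split (λ _ → 0) (unit ℓ 1))


  linear-unit : ∀ ℓ w a b → linear (split (λ _ → 0) (unit ℓ w)) (a ++ b) ≡ w * bit (lookup b ℓ)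
  linear-unit ℓ w a b = trans (linear-split (λ _ → 0) (unit ℓ w) a b)
    (cong₂ _+_ (Σℕ.sum-replicate-zero n) (sum-unit ℓ w (λ j → bit (lookup b j))))

  bitTest : Bool → Bool → ℕ
  bitTest β v = if β then 1 + (p ∸ 1) * bit v else 1 * bit v

  1%p≢0 : ¬ (1 % p ≡ 0)
  1%p≢0 e = contradiction (trans (sym (m<n⇒m%n≡m (IntegersModPrime.1<p p p-prime))) e) λ ()

  bitTest-vanishes : ∀ β v → bitTest β v % p ≡ 0 → v ≡ β
  bitTest-vanishes true  true  _ = refl
  bitTest-vanishes true  false h = contradiction (trans (cong (λ x → (1 + x) % p) (sym (ℕₚ.*-zeroʳ (p ∸ 1)))) h) 1%p≢0
  bitTest-vanishes false true  h = contradiction h 1%p≢0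
  bitTest-vanishes false false _ = refl

  bitTest-self : ∀ β → bitTest β β % p ≡ 0
  bitTest-self true  = trans (cong (λ x → (1 + x) % p) (ℕₚ.*-identityʳ (p ∸ 1))) (trans (cong (_% p) (ℕₚ.suc-pred p)) (n%n≡0 p))
  bitTest-self false = m<n⇒m%n≡m (Nat.>-nonZero⁻¹ p)

  value-bitForm : ∀ β ℓ a b → value (bitForm β ℓ) (a ++ b) ≡ bitTest (lookup β ℓ) (lookup b ℓ)
  value-bitForm β ℓ a b with lookup β ℓ
  ... | true  = cong suc (linear-unit ℓ (p ∸ 1) a b)
  ... | false = linear-unit ℓ 1 a b

  k : ℕ
  k = r + r

  tests : Vec Bool r → Vec Form k
  tests β = tabulate ([ coordForm β , bitForm β ]′ ∘ splitAt r)

  testValues : Vec Bool r → Vec Bool n → Vec Bool r → Vec ℕ k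
  testValues β a b = Vec.map (λ f → value f (a ++ b)) (tests β)

  lookup-testValues : ∀ β a b j → lookup (testValues β a b) j ≡ value ([ coordForm β , bitForm β ]′ (splitAt r j)) (a ++ b)
  lookup-testValues β a b j = trans (Vecₚ.lookup-map j _ (tests β)) (cong (λ f → value f (a ++ b)) (Vecₚ.lookup∘tabulate _ j))

  allVanish⇒ : ∀ β a b → AllVanish (testValues β a b) → b ≡ β × Root a β
  allVanish⇒ β a b vanish =
      vec-ext (λ ℓ → bitTest-vanishes (lookup β ℓ) (lookup b ℓ)
        (trans (cong (_% p) (sym (value-bitForm β ℓ a b))) (vanishing (r ↑ʳ ℓ) (Finₚ.splitAt-↑ʳ r r ℓ))))
    , coord≡0⇒≡0# _ (λ ℓ → trans (sym (value-coordForm β ℓ a b)) (vanishing (ℓ ↑ˡ r) (Finₚ.splitAt-↑ˡ r ℓ r)))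
    where
    vanishing : ∀ j {s} → splitAt r j ≡ s → value ([ coordForm β , bitForm β ]′ s) (a ++ b) % p ≡ 0
    vanishing j refl = trans (cong (_% p) (sym (lookup-testValues β a b j))) (vanish j)

  allVanish⇐ : ∀ β a b → b ≡ β → Root a β → AllVanish (testValues β a b)
  allVanish⇐ β a b refl root j = trans (cong (_% p) (lookup-testValues β a b j)) (vanishes (splitAt r j))
    where
    vanishes : ∀ s → value ([ coordForm β , bitForm β ]′ s) (a ++ b) % p ≡ 0
    vanishes (inj₁ ℓ) = trans (value-coordForm β ℓ a b) (trans (cong (λ z → coord z ℓ) root) (coord-0# ℓ))
    vanishes (inj₂ ℓ) = trans (cong (_% p) (value-bitForm β ℓ a b)) (bitTest-self (lookup β ℓ))

  P : ℕ
  P = p ^ k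

  block : Vec Bool r → List Gate
  block β = orGates k (tests β) zeroForm

  gates : List Gate
  gates = concatMap block (allVecs r)

  Γ : Circuit2 (p * u₁) (q * u₂) (n + r)
  Γ = circuit gates P

  accept : Vec Bool n → Vec Bool r → ℕ
  accept a b = if does (root? a b) then P else 0

  block-contribution : ∀ a b β → sum (map (contribution (a ++ b)) (block β)) % q ≡ indicator b (accept a b) β % q
  block-contribution a b β = trans (cong (_% q) block≡orSum) (by-cases (β ≟ᵛ b) (root? a b))
    where
    block≡orSum : sum (map (contribution (a ++ b)) (block β)) ≡ ORGadget.orSum p q k (testValues β a b) 0
    block≡orSum = trans (sum-contribution-orGates k (tests β) zeroForm (a ++ b))
                        (cong (ORGadget.orSum p q k (testValues β a b)) (value-zeroForm (a ++ b)))
    silent : ¬ AllVanish (testValues β a b) → ORGadget.orSum p q k (testValues β a b) 0 % q ≡ 0 % q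
    silent ¬vanish = trans (n∣m⇒m%n≡0 _ q (orSum-¬allVanish p-prime k _ 0 ¬vanish))
                           (sym (m<n⇒m%n≡m (Nat.>-nonZero⁻¹ q)))
    by-cases : (β≟b : Dec (β ≡ b)) (root : Dec (Root a b)) →
      ORGadget.orSum p q k (testValues β a b) 0 % q ≡ (if does β≟b then (if does root then P else 0) else 0) % q
    by-cases (no β≢b)    _          = silent (λ vanish → β≢b (sym (proj₁ (allVanish⇒ β a b vanish))))
    by-cases (yes refl) (no ¬root) = silent (λ vanish → ¬root (proj₂ (allVanish⇒ β a b vanish)))
    by-cases (yes refl) (yes root) = cong (_% q) (trans (orSum-allVanish k _ 0 (allVanish⇐ β a β refl root))
      (trans (cong (λ v → P * ORGadget.weight p q v) (m<n⇒m%n≡m (Nat.>-nonZero⁻¹ p)))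
             (trans (cong (λ v → P * suc v) (ℕₚ.*-zeroʳ (q ∸ 1))) (ℕₚ.*-identityʳ P))))

  total-contribution : ∀ a b → sum (map (contribution (a ++ b)) gates) % q ≡ accept a b % q
  total-contribution a b = begin
    sum (map (contribution (a ++ b)) (concatMap block (allVecs r))) % q  ≡⟨ cong (_% q) (sum-map-concatMap block _ (allVecs r)) ⟩
    sum (map blockSum (allVecs r)) % q                                  ≡⟨ sum-map-% blockSum (allVecs r) q ⟩
    sum (map ((_% q) ∘ blockSum) (allVecs r)) % q                       ≡⟨ cong (λ xs → sum xs % q) (Listₚ.map-cong (block-contribution a b) (allVecs r)) ⟩
    sum (map ((_% q) ∘ indicator b (accept a b)) (allVecs r)) % q       ≡⟨ sum-map-% (indicator b (accept a b)) (allVecs r) q ⟨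
    sum (map (indicator b (accept a b)) (allVecs r)) % q                ≡⟨ cong (_% q) (sum-indicator-allVecs r b (accept a b)) ⟩
    accept a b % q                                                      ∎
    where
    open ≡-Reasoning
    blockSum : Vec Bool r → ℕ
    blockSum β = sum (map (contribution (a ++ b)) (block β))

  eval-Γ : ∀ a b → eval Γ (a ++ b) ≡ does (root? a b)
  eval-Γ a b = trans (eval-circuit gates P (a ++ b)) (trans (cong (_≡ᵇ P % q) (total-contribution a b)) (decide (root? a b)))
    where
    P%q≢0 : ¬ (P % q ≡ 0)
    P%q≢0 P%q≡0 = prime∤prime^ p-prime q-prime p≢q k (m%n≡0⇒n∣m P q P%q≡0)
    decide : (d : Dec (Root a b)) → ((if does d then P else 0) % q ≡ᵇ P % q) ≡ does d
    decide (yes _) = dec-true (P % q Nat.≟ P % q) refl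
    decide (no _)  = dec-false (0 % q Nat.≟ P % q) λ e → P%q≢0 (trans (sym e) (m<n⇒m%n≡m (Nat.>-nonZero⁻¹ q)))

  randomPoint-injective : ∀ {β β′} → randomPoint β ≡ randomPoint β′ → β ≡ β′
  randomPoint-injective {β} {β′} e = vec-ext λ ℓ → bit-injective (begin
    bit (lookup β ℓ)               ≡⟨ coord-fromBits (lookup β) ℓ ⟨
    coord (randomPoint β) ℓ        ≡⟨ cong (λ z → coord z ℓ) e ⟩
    coord (randomPoint β′) ℓ       ≡⟨ coord-fromBits (lookup β′) ℓ ⟩
    bit (lookup β′ ℓ)              ∎)
    where
    open ≡-Reasoning
    bit-injective : ∀ {u v} → bit u ≡ bit v → u ≡ v
    bit-injective {false} {false} _ = refl
    bit-injective {true}  {true}  _ = refl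

  roots : Vec Bool n → List (Vec Bool r)
  roots a = List.filter (root? a) (allVecs r)

  #roots<n : ∀ a → (∃ λ i → lookup a i ≡ false) → length (roots a) < n
  #roots<n a (i , aᵢ≡false) =
    let D , D<n , monic = bitPoly-isMonic (zeros a) (i , trans (Vecₚ.lookup-map i not a) (cong not aᵢ≡false))
    in ℕₚ.≤-<-trans (ℕₚ.≤-trans (ℕₚ.≤-reflexive (sym (Listₚ.length-map randomPoint (roots a))))
         (roots-bound D _ monic (map randomPoint (roots a))
           (Uniqueₚ.map⁺ randomPoint-injective (Uniqueₚ.filter⁺ (root? a) (allVecs-unique r)))
           (Allₚ.map⁺ (Allₚ.all-filter (root? a) (allVecs r))))) D<n

  goodCount-AND≡true : ∀ a → AND a ≡ true → goodCount Γ a ≡ 2 ^ r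
  goodCount-AND≡true a AND≡true = trans (cong length (Listₚ.filter-all _ (universal accepted (allVecs r)))) (length-allVecs r)
    where
    root : ∀ b → Root a b
    root b = bitPoly-allFalse (zeros a) (λ i → trans (Vecₚ.lookup-map i not a) (cong not (AND≡true⇒ a AND≡true i))) (randomPoint b)
    accepted : ∀ b → eval Γ (a ++ b) ≡ AND a
    accepted b = trans (eval-Γ a b) (trans (dec-true (root? a b) (root b)) (sym AND≡true))

  goodCount-AND≡false : ∀ a → AND a ≡ false → goodCount Γ a Nat.+ length (roots a) ≡ 2 ^ r
  goodCount-AND≡false a AND≡false = begin
    goodCount Γ a + length (roots a)                              ≡⟨ cong (λ xs → length xs + length (roots a)) good≡nonRoots ⟩
    length (List.filter (¬? ∘ root? a) (allVecs r)) + length (roots a) ≡⟨ ℕₚ.+-comm _ (length (roots a)) ⟩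
    length (roots a) + length (List.filter (¬? ∘ root? a) (allVecs r)) ≡⟨ length-filter-∁ (root? a) (allVecs r) ⟩
    length (allVecs r)                                            ≡⟨ length-allVecs r ⟩
    2 ^ r                                                         ∎
    where
    open ≡-Reasoning
    rejected⇒nonRoot : ∀ {b} → eval Γ (a ++ b) ≡ AND a → ¬ Root a b
    rejected⇒nonRoot {b} rejected root =
      contradiction (trans (sym (trans rejected AND≡false)) (trans (eval-Γ a b) (dec-true (root? a b) root))) λ ()
    nonRoot⇒rejected : ∀ {b} → ¬ Root a b → eval Γ (a ++ b) ≡ AND a
    nonRoot⇒rejected {b} ¬root = trans (eval-Γ a b) (trans (dec-false (root? a b) ¬root) (sym AND≡false))
    good≡nonRoots : List.filter (λ b → eval Γ (a ++ b) ≟ᵇ AND a) (allVecs r) ≡ List.filter (¬? ∘ root? a) (allVecs r)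
    good≡nonRoots = Listₚ.filter-≐ _ (¬? ∘ root? a) (rejected⇒nonRoot , nonRoot⇒rejected) (allVecs r)

  goodCount-bound : 3 * n ≤ 2 ^ r → ∀ a → 2 * 2 ^ r ≤ 3 * goodCount Γ a
  goodCount-bound 3n≤2^r a = by-cases (AND a) refl
    where
    by-cases : ∀ v → AND a ≡ v → 2 * 2 ^ r ≤ 3 * goodCount Γ a
    by-cases true  AND≡true  = subst (λ g → 2 * 2 ^ r ≤ 3 * g) (sym (goodCount-AND≡true a AND≡true))
                                     (ℕₚ.*-monoˡ-≤ (2 ^ r) (ℕₚ.n≤1+n 2))
    by-cases false AND≡false = two-thirds (goodCount-AND≡false a AND≡false) (#roots<n a (AND≡false⇒ a AND≡false)) 3n≤2^r

  size-Γ : size Γ ≡ suc (2 ^ r * (2 * P))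
  size-Γ = cong suc (begin
    length (concatMap block (allVecs r))        ≡⟨ length-concatMap block (allVecs r) ⟩
    sum (map (length ∘ block) (allVecs r))      ≡⟨ cong sum (Listₚ.map-cong (λ β → length-orGates k (tests β) zeroForm) (allVecs r)) ⟩
    sum (map (λ _ → 2 * P) (allVecs r))         ≡⟨ sum-map-const (allVecs r) (2 * P) ⟩
    length (allVecs r) * (2 * P)                ≡⟨ cong (_* (2 * P)) (length-allVecs r) ⟩
    2 ^ r * (2 * P)                             ∎)
    where open ≡-Reasoning

-- Number of random bits and circuit size

module BitLength where

  open Nat using (_+_; _*_; _^_; _<?_; _≤?_)

  search : (m fuel i : ℕ) → ℕ
  search m zero       i = i
  search m (suc fuel) i with m <? 2 ^ i
  ... | yes _ = i
  ... | no  _ = search m fuel (suc i)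

  -- The least j with m < 2 ^ j; m + 1 search steps suffice since m < 2 ^ m.
  bitLength : ℕ → ℕ
  bitLength m = search m (suc m) 0

  BelowAll : ℕ → ℕ → Set
  BelowAll m i = ∀ j → j < i → 2 ^ j ≤ m

  search-belowAll : ∀ m fuel i → BelowAll m i → BelowAll m (search m fuel i)
  search-belowAll m zero       i below = below
  search-belowAll m (suc fuel) i below with m <? 2 ^ i
  ... | yes _    = below
  ... | no  m≮2ⁱ = search-belowAll m fuel (suc i) below′
    where
    below′ : BelowAll m (suc i)
    below′ j (Nat.s≤s j≤i) with ℕₚ.m≤n⇒m<n∨m≡n j≤i
    ... | inj₁ j<i  = below j j<i
    ... | inj₂ refl = ℕₚ.≮⇒≥ m≮2ⁱ

  search-sound : ∀ m fuel i → m < 2 ^ (i + fuel) → m < 2 ^ search m fuel i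
  search-sound m zero       i h = subst (λ j → m < 2 ^ j) (ℕₚ.+-identityʳ i) h
  search-sound m (suc fuel) i h with m <? 2 ^ i
  ... | yes m<2ⁱ = m<2ⁱ
  ... | no  _    = search-sound m fuel (suc i) (subst (λ j → m < 2 ^ j) (ℕₚ.+-suc i fuel) h)

  n<2^n : ∀ n → n < 2 ^ n
  n<2^n zero    = Nat.s≤s Nat.z≤n
  n<2^n (suc n) = ℕₚ.+-mono-≤ (ℕₚ.m^n>0 2 n) (subst (n <_) (sym (ℕₚ.+-identityʳ (2 ^ n))) (n<2^n n))

  <2^bitLength : ∀ m → m < 2 ^ bitLength m
  <2^bitLength m = search-sound m (suc m) 0 (ℕₚ.<-trans (n<2^n m) (ℕₚ.^-monoʳ-< 2 (ℕₚ.n<1+n 1) (ℕₚ.n<1+n m)))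

  bitLength-belowAll : ∀ m → BelowAll m (bitLength m)
  bitLength-belowAll m = search-belowAll m (suc m) 0 λ _ ()

  bitLength-least : ∀ m j → m < 2 ^ j → bitLength m ≤ j
  bitLength-least m j m<2ʲ with bitLength m ≤? j
  ... | yes ≤j = ≤j
  ... | no  ≰j = contradiction (bitLength-belowAll m j (ℕₚ.≰⇒> ≰j)) (ℕₚ.<⇒≱ m<2ʲ)

  2^bitLength≤ : ∀ m → 2 ^ bitLength m ≤ 2 * m + 1
  2^bitLength≤ m with bitLength m | bitLength-belowAll m
  ... | zero  | _     = ℕₚ.m≤n+m 1 (2 * m)
  ... | suc j | below = ℕₚ.≤-trans (ℕₚ.*-monoʳ-≤ 2 (below j (ℕₚ.n<1+n j))) (ℕₚ.m≤m+n (2 * m) 1)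

module Growth where

  open Nat using (_+_; _*_; _^_)
  open ℕₚ.≤-Reasoning
  open +-*-Solver

  *-^ : ∀ a b d → (a * b) ^ d ≡ a ^ d * b ^ d
  *-^ a b zero    = refl
  *-^ a b (suc d) = trans (cong (a * b *_) (*-^ a b d))
    (solve 4 (λ a b x y → a :* b :* (x :* y) := a :* x :* (b :* y)) refl a b (a ^ d) (b ^ d))

  ^-≤-square : ∀ b .{{_ : NonZero b}} {ℓ r X} → r ≤ suc (ℓ + ℓ) → b ^ ℓ ≤ X → b ^ r ≤ b * (X * X)
  ^-≤-square b {ℓ} {r} {X} r≤ bˡ≤X = begin
    b ^ r                 ≤⟨ ℕₚ.^-monoʳ-≤ b r≤ ⟩
    b * b ^ (ℓ + ℓ)       ≡⟨ cong (b *_) (ℕₚ.^-distribˡ-+-* b ℓ ℓ) ⟩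
    b * (b ^ ℓ * b ^ ℓ)   ≤⟨ ℕₚ.*-monoʳ-≤ b (ℕₚ.*-mono-≤ bˡ≤X bˡ≤X) ⟩
    b * (X * X)           ∎

  p^ℓ≤[2^ℓ]^p : ∀ p ℓ → p ^ ℓ ≤ (2 ^ ℓ) ^ p
  p^ℓ≤[2^ℓ]^p p ℓ = begin
    p ^ ℓ                 ≤⟨ ℕₚ.^-monoˡ-≤ ℓ (ℕₚ.<⇒≤ (BitLength.n<2^n p)) ⟩
    (2 ^ p) ^ ℓ           ≡⟨ ℕₚ.^-*-assoc 2 p ℓ ⟩
    2 ^ (p * ℓ)           ≡⟨ cong (2 ^_) (ℕₚ.*-comm p ℓ) ⟩
    2 ^ (ℓ * p)           ≡⟨ ℕₚ.^-*-assoc 2 ℓ p ⟨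
    (2 ^ ℓ) ^ p           ∎

  degree : ℕ → ℕ
  degree p = 2 + p * 4

  gates-bound : ∀ p .{{_ : NonZero p}} {ℓ r M} → r ≤ suc (ℓ + ℓ) → 2 ^ ℓ ≤ M →
                2 ^ r * (2 * p ^ (r + r)) ≤ 4 * p * p * M ^ degree p
  gates-bound p {ℓ} {r} {M} r≤ 2ˡ≤M = begin
    2 ^ r * (2 * p ^ (r + r))                               ≡⟨ cong (λ x → 2 ^ r * (2 * x)) (ℕₚ.^-distribˡ-+-* p r r) ⟩
    2 ^ r * (2 * (p ^ r * p ^ r))                           ≤⟨ ℕₚ.*-mono-≤ (^-≤-square 2 {ℓ} r≤ 2ˡ≤M)
                                                                 (ℕₚ.*-monoʳ-≤ 2 (ℕₚ.*-mono-≤ p^r≤ p^r≤)) ⟩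
    2 * (M * M) * (2 * ((p * (Mᵖ * Mᵖ)) * (p * (Mᵖ * Mᵖ))))  ≡⟨ solve 3 (λ p M Mᵖ →
                                                                   con 2 :* (M :* M) :* (con 2 :* ((p :* (Mᵖ :* Mᵖ)) :* (p :* (Mᵖ :* Mᵖ))))
                                                                := con 4 :* p :* p :* (M :* (M :* con 1) :* (Mᵖ :* (Mᵖ :* (Mᵖ :* (Mᵖ :* con 1))))))
                                                                 refl p M Mᵖ ⟩
    4 * p * p * (M ^ 2 * (Mᵖ) ^ 4)                          ≡⟨ cong (λ x → 4 * p * p * (M ^ 2 * x)) (ℕₚ.^-*-assoc M p 4) ⟩
    4 * p * p * (M ^ 2 * M ^ (p * 4))                       ≡⟨ cong (4 * p * p *_) (ℕₚ.^-distribˡ-+-* M 2 (p * 4)) ⟨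
    4 * p * p * M ^ degree p                                ∎
    where
    Mᵖ : ℕ
    Mᵖ = M ^ p
    p^r≤ : p ^ r ≤ p * (Mᵖ * Mᵖ)
    p^r≤ = ^-≤-square p {ℓ} r≤ (ℕₚ.≤-trans (p^ℓ≤[2^ℓ]^p p ℓ) (ℕₚ.^-monoˡ-≤ p 2ˡ≤M))

  constant : ℕ → ℕ
  constant p = 7 + 4 * p * p * 8 ^ degree p

  size-polynomial : ∀ p .{{_ : NonZero p}} {ℓ r n} → r ≤ suc (ℓ + ℓ) → 2 ^ ℓ ≤ 8 * suc n →
                    suc (2 ^ r * (2 * p ^ (r + r))) ≤ constant p * suc n ^ degree p
  size-polynomial p {ℓ} {r} {n} r≤ 2ˡ≤M = begin
    suc (2 ^ r * (2 * p ^ (r + r)))                   ≤⟨ Nat.s≤s (gates-bound p {ℓ} r≤ 2ˡ≤M) ⟩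
    suc (4 * p * p * (8 * suc n) ^ degree p)          ≡⟨ cong (λ x → suc (4 * p * p * x)) (*-^ 8 (suc n) (degree p)) ⟩
    suc (4 * p * p * (8 ^ degree p * N))              ≡⟨ cong suc (ℕₚ.*-assoc (4 * p * p) (8 ^ degree p) N) ⟨
    suc (A * N)                                       ≤⟨ ℕₚ.+-monoˡ-≤ (A * N) (ℕₚ.≤-trans (ℕₚ.m^n>0 (suc n) (degree p)) (ℕₚ.m≤m*n N 7)) ⟩
    N * 7 + A * N                                     ≡⟨ solve 2 (λ N A → N :* con 7 :+ A :* N := (con 7 :+ A) :* N) refl N A ⟩
    constant p * N                                    ∎
    where
    N A : ℕ
    N = suc n ^ degree p
    A = 4 * p * p * 8 ^ degree p

module Parameters (n : ℕ) where

  open Nat using (_+_; _*_; _^_)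
  open BitLength
  open ℕₚ.≤-Reasoning
  open +-*-Solver

  -- 2 ^ ℓ is about 4n, and the number of random bits 2 ^ J is about 2ℓ.
  ℓ J : ℕ
  ℓ = bitLength (4 * n)
  J = bitLength ℓ

  2^J≤1+2ℓ : 2 ^ J ≤ suc (ℓ + ℓ)
  2^J≤1+2ℓ = begin
    2 ^ J             ≤⟨ 2^bitLength≤ ℓ ⟩
    2 * ℓ + 1         ≡⟨ solve 1 (λ ℓ → con 2 :* ℓ :+ con 1 := con 1 :+ (ℓ :+ ℓ)) refl ℓ ⟩
    suc (ℓ + ℓ)       ∎

  2^ℓ≤8[1+n] : 2 ^ ℓ ≤ 8 * suc n
  2^ℓ≤8[1+n] = begin
    2 ^ ℓ                     ≤⟨ 2^bitLength≤ (4 * n) ⟩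
    2 * (4 * n) + 1           ≤⟨ ℕₚ.m≤m+n _ 7 ⟩
    2 * (4 * n) + 1 + 7       ≡⟨ solve 1 (λ n → con 2 :* (con 4 :* n) :+ con 1 :+ con 7 := con 8 :* (con 1 :+ n)) refl n ⟩
    8 * suc n                 ∎

  3n≤2^2^J : 3 * n ≤ 2 ^ 2 ^ J
  3n≤2^2^J = begin
    3 * n             ≤⟨ ℕₚ.*-monoˡ-≤ n (ℕₚ.n≤1+n 3) ⟩
    4 * n             ≤⟨ ℕₚ.<⇒≤ (<2^bitLength (4 * n)) ⟩
    2 ^ ℓ             ≤⟨ ℕₚ.^-monoʳ-≤ 2 (ℕₚ.<⇒≤ (<2^bitLength ℓ)) ⟩
    2 ^ 2 ^ J         ∎

  n<2^[1+log₂n] : n < 2 ^ suc ⌊log₂ n ⌋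
  n<2^[1+log₂n] with n Nat.<? 2 ^ suc ⌊log₂ n ⌋
  ... | yes n<2ᴸ = n<2ᴸ
  ... | no  n≮2ᴸ = contradiction (subst (_≤ ⌊log₂ n ⌋) (⌊log₂[2^n]⌋≡n (suc ⌊log₂ n ⌋)) (⌊log₂⌋-mono-≤ (ℕₚ.≮⇒≥ n≮2ᴸ)))
                                 (ℕₚ.<-irrefl refl)

  ℓ≤3+log₂n : ℓ ≤ 3 + ⌊log₂ n ⌋
  ℓ≤3+log₂n = bitLength-least (4 * n) (3 + ⌊log₂ n ⌋) (begin-strict
    4 * n                           <⟨ ℕₚ.*-monoʳ-< 4 n<2^[1+log₂n] ⟩
    4 * 2 ^ suc ⌊log₂ n ⌋           ≡⟨ solve 1 (λ x → con 4 :* (con 2 :* x) := con 2 :* (con 2 :* (con 2 :* x))) refl (2 ^ ⌊log₂ n ⌋) ⟩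
    2 ^ (3 + ⌊log₂ n ⌋)             ∎)

  2^J≤7[1+log₂n] : 2 ^ J ≤ 7 * suc ⌊log₂ n ⌋
  2^J≤7[1+log₂n] = begin
    2 ^ J                                   ≤⟨ 2^J≤1+2ℓ ⟩
    suc (ℓ + ℓ)                             ≤⟨ Nat.s≤s (ℕₚ.+-mono-≤ ℓ≤3+log₂n ℓ≤3+log₂n) ⟩
    suc (3 + L + (3 + L))                   ≡⟨ solve 1 (λ L → con 1 :+ ((con 3 :+ L) :+ (con 3 :+ L)) := con 7 :+ con 2 :* L) refl L ⟩
    7 + 2 * L                               ≤⟨ ℕₚ.+-monoʳ-≤ 7 (ℕₚ.*-monoˡ-≤ L (ℕₚ.m≤m+n 2 5)) ⟩
    7 + 7 * L                               ≡⟨ solve 1 (λ L → con 7 :+ con 7 :* L := con 7 :* (con 1 :+ L)) refl L ⟩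
    7 * suc L                               ∎
    where
    L : ℕ
    L = ⌊log₂ n ⌋

module Bounds (p q u₁ u₂ : ℕ) .{{_ : NonZero p}} .{{_ : NonZero q}} .{{_ : NonZero u₁}} .{{_ : NonZero u₂}}
              (p-prime : Prime p) (q-prime : Prime q) (p≢q : p ≢ q) (n : ℕ) where

  open Nat using (_+_; _*_; _^_)
  open Parameters n
  open Growth using (constant; degree; size-polynomial)
  open RandomisedAND p q u₁ u₂ p-prime q-prime p≢q J n public using (r; Γ; goodCount-bound; size-Γ)

  r≡2^J : r ≡ 2 ^ J
  r≡2^J = dim-fieldTower p-prime J

  r-bound : r ≤ constant p * suc ⌊log₂ n ⌋
  r-bound = subst (_≤ constant p * suc ⌊log₂ n ⌋) (sym r≡2^J)
    (ℕₚ.≤-trans 2^J≤7[1+log₂n] (ℕₚ.*-monoˡ-≤ (suc ⌊log₂ n ⌋) (ℕₚ.m≤m+n 7 (4 * p * p * 8 ^ degree p))))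

  size-bound : size Γ ≤ constant p * suc n ^ degree p
  size-bound = subst (_≤ constant p * suc n ^ degree p) (sym size-Γ)
    (size-polynomial p {ℓ} (subst (_≤ suc (ℓ + ℓ)) (sym r≡2^J) 2^J≤1+2ℓ) 2^ℓ≤8[1+n])

  3n≤2^r : 3 * n ≤ 2 ^ r
  3n≤2^r = subst (λ x → 3 * n ≤ 2 ^ x) (sym r≡2^J) 3n≤2^2^J

probANDFamily : ∀ p q u₁ u₂ .{{_ : NonZero p}} .{{_ : NonZero q}} .{{_ : NonZero u₁}} .{{_ : NonZero u₂}} →
                Prime p → Prime q → p ≢ q → ProbANDFamily (p Nat.* u₁) (q Nat.* u₂)
probANDFamily p q u₁ u₂ p-prime q-prime p≢q = Growth.constant p , Growth.degree p , λ n →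
  let open Bounds p q u₁ u₂ p-prime q-prime p≢q n
  in r , r-bound , Γ , size-bound , goodCount-bound 3n≤2^r

ProbANDFamily-cong : ∀ {m₁ m₁′ m₂ m₂′} .{{_ : NonZero m₁}} .{{_ : NonZero m₂}} .{{_ : NonZero m₁′}} .{{_ : NonZero m₂′}} →
                     m₁ ≡ m₁′ → m₂ ≡ m₂′ → ProbANDFamily m₁ m₂ → ProbANDFamily m₁′ m₂′
ProbANDFamily-cong refl refl family = family

first-two : ∀ {P : ℕ → Set} (xs : List ℕ) → All P xs → Unique xs → 2 ≤ length xs → Σ ℕ λ p → Σ ℕ λ q → P p × P q × p ≢ q
first-two (p ∷ q ∷ _) (Pp ∷ Pq ∷ _) ((p≢q ∷ _) ∷ _) _ = p , q , Pp , Pq , p≢q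
first-two (_ ∷ [])    _                _               (Nat.s≤s ())

two-prime-divisors : ∀ m → 2 ≤ ω m → Σ ℕ λ p → Σ ℕ λ q → (Prime p × p ∣ m) × (Prime q × q ∣ m) × p ≢ q
two-prime-divisors m 2≤ω = first-two (List.filter prime-divisor? (List.upTo (suc m)))
  (Allₚ.all-filter prime-divisor? (List.upTo (suc m))) (Uniqueₚ.filter⁺ prime-divisor? (Uniqueₚ.upTo⁺ (suc m))) 2≤ω
  where
  prime-divisor? : ∀ p → Dec (Prime p × p ∣ m)
  prime-divisor? p = prime? p ×-dec p ∣? m

probANDFamily-ω≥2 : ∀ m .{{_ : NonZero m}} → 2 ≤ ω m → ProbANDFamily m m
probANDFamily-ω≥2 m 2≤ω = from-divisors (two-prime-divisors m 2≤ω)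
  where
  from-divisors : (Σ ℕ λ p → Σ ℕ λ q → (Prime p × p ∣ m) × (Prime q × q ∣ m) × p ≢ q) → ProbANDFamily m m
  from-divisors (p , q , (p-prime , p∣m) , (q-prime , q∣m) , p≢q) =
    ProbANDFamily-cong {{*-nonZero {{p≢0}} {{u≢0}}}} {{*-nonZero {{q≢0}} {{v≢0}}}}
      (sym (m∣n⇒n≡m*quotient p∣m)) (sym (m∣n⇒n≡m*quotient q∣m))
      (probANDFamily p q (quotient p∣m) (quotient q∣m) {{p≢0}} {{q≢0}} {{u≢0}} {{v≢0}} p-prime q-prime p≢q)
    where
    p≢0 : NonZero p
    p≢0 = prime⇒nonZero p-prime
    q≢0 : NonZero q
    q≢0 = prime⇒nonZero q-prime
    u≢0 : NonZero (quotient p∣m)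
    u≢0 = quotient≢0 p∣m
    v≢0 : NonZero (quotient q∣m)
    v≢0 = quotient≢0 q∣m

theorem1p3 : ((m : ℕ) .{{_ : NonZero m}} → 2 ≤ ω m → ProbANDFamily m m)
    × ((p q : ℕ) .{{_ : NonZero p}} .{{_ : NonZero q}} → Prime p → Prime q → p ≢ q → ProbANDFamily p q)
theorem1p3 = probANDFamily-ω≥2 , λ p q p-prime q-prime p≢q →
  ProbANDFamily-cong (ℕₚ.*-identityʳ p) (ℕₚ.*-identityʳ q) (probANDFamily p q 1 1 p-prime q-prime p≢q)
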